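{- Let $\ell\ge 2$ be an integer and $n=4\ell+2$. Then $\operatorname{capt}(H(n),3)=2\ell+3(n-4)$.
   Context: All graphs are finite, simple apart from loops, connected and reflexive. The game of one cop and $m$ robbers: in round $0$ the cop chooses a starting vertex, then the robbers choose starting vertices (players may share vertices). In each round $i\ge1$ the cop moves to an adjacent vertex or stays, then every robber moves to an adjacent vertex or stays. Whenever the cop occupies the same vertex as some robbers, those robbers are captured and leave the game. For a cop-win graph $G$, $\operatorname{capt}(G,m)$ is the smallest $t$ such that the cop has a strategy guaranteeing all $m$ robbers are captured by round $t$ regardless of the robbers' play. The graph $H(7)$ has vertex set $\{1,\dots,7\}$ and edges $62,21,14$ (a path $6,2,1,4$), $56,52,51,54,36,32,31,34$ (vertices $3$ and $5$ are adjacent to all of $6,2,1,4$ but not to each other) and $76,74,73$. For $n\ge 8$, $H(n)$ is obtained from $H(n-1)$ by adding a vertex $n$ adjacent to $n-1$, $n-3$ and $n-4$. -}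

module Defs where

open import Data.Nat using (ℕ; zero; suc; _+_; _*_; _∸_; _≤_; _<_)
open import Data.Fin using (Fin; toℕ)
open import Data.Maybe using (Maybe; just; nothing)
open import Data.Vec using (Vec; []; _∷_; map)
open import Data.Product using (Σ; _×_; _,_)
open import Data.Sum using (_⊎_)
open import Relation.Nullary using (¬_; Dec; yes; no)
open import Relation.Binary.PropositionalEquality using (_≡_)

-- V : vertices, Adj : closed adjacency (must contain equality, i.e. the
-- graph is reflexive: staying put is a legal move), _≟_ : decidable
-- equality on vertices (used to detect captures).

module Game {V : Set} (Adj : V → V → Set)
            (_≟_ : (x y : V) → Dec (x ≡ y)) where

  -- a robber is either alive at a vertex or already captured
  Robber : Set
  Robber = Maybe V

  catch : V → Robber → Robber
  catch c nothing = nothing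
  catch c (just r) with r ≟ c
  ... | yes _ = nothing
  ... | no  _ = just r

  catchAll : ∀ {m} → V → Vec Robber m → Vec Robber m
  catchAll c = map (catch c)

  data Step : Robber → Robber → Set where
    dead  : Step nothing nothing
    alive : ∀ {r r'} → Adj r r' → Step (just r) (just r')

  data Steps : ∀ {m} → Vec Robber m → Vec Robber m → Set where
    []  : Steps [] []
    _∷_ : ∀ {m x y} {xs ys : Vec Robber m} →
          Step x y → Steps xs ys → Steps (x ∷ xs) (y ∷ ys)

  data AllCaptured : ∀ {m} → Vec Robber m → Set where
    []  : AllCaptured []
    _∷_ : ∀ {m} {xs : Vec Robber m} → AllCaptured xs → AllCaptured (nothing ∷ xs)

  -- Win k c rs : the cop stands at c, the robbers are in state rs (captures
  -- at c already performed), k rounds remain; the cop can guarantee that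
  -- all robbers are captured by the end of these k rounds.
  Win : ∀ {m} → ℕ → V → Vec Robber m → Set
  Win zero    c rs = AllCaptured rs
  Win (suc k) c rs =
    Σ V λ c' → Adj c c' ×
      (∀ rs' → Steps (catchAll c' rs) rs' → Win k c' (catchAll c' rs'))

  CaptureBy : ℕ → ℕ → Set
  CaptureBy m t =
    Σ V λ c → ∀ (rs : Vec V m) → Win t c (catchAll c (map just rs))

  CaptTime : ℕ → ℕ → Set
  CaptTime m T = CaptureBy m T × (∀ t → t < T → ¬ CaptureBy m t)

-- The graphs H(n).  Vertex i : Fin n is the paper's vertex (toℕ i + 1).

data HEdge : ℕ → ℕ → Set where
  e62 : HEdge 6 2
  e21 : HEdge 2 1
  e41 : HEdge 4 1
  e65 : HEdge 6 5
  e52 : HEdge 5 2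
  e51 : HEdge 5 1
  e54 : HEdge 5 4
  e63 : HEdge 6 3
  e32 : HEdge 3 2
  e31 : HEdge 3 1
  e43 : HEdge 4 3
  e76 : HEdge 7 6
  e74 : HEdge 7 4
  e73 : HEdge 7 3
  ext1 : ∀ k → HEdge (8 + k) (7 + k)
  ext3 : ∀ k → HEdge (8 + k) (5 + k)
  ext4 : ∀ k → HEdge (8 + k) (4 + k)

HAdj : (n : ℕ) → Fin n → Fin n → Set
HAdj n i j = (i ≡ j) ⊎ HEdge (suc (toℕ i)) (suc (toℕ j))
                     ⊎ HEdge (suc (toℕ j)) (suc (toℕ i))

{-# OPTIONS --safe #-}
-- Upper bound: the cop catches the robbers one at a time.  From vertex 1 or 2 it catches a
-- robber within n − 4 rounds by shadowing it from below in the robber's residue class mod 4,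
-- never more than three labels behind the round counter, which drives it up to n before time
-- runs out; and it walks down to {1, 2} from anywhere in ℓ moves.  So (n − 4) + 2 (ℓ + n − 4)
-- rounds suffice.
--
-- Lower bound: each robber keeps one of a few positions relative to the cop (a Shape) whose
-- potential bounds the rounds still needed for it and drops by at most one per round.  The one
-- exception is a robber on n while the cop moves to n − 4; the three robbers then scatter to the
-- distinct vertices n, n − 1, n − 3, so the cop catches at most one, and the others regain a
-- Shape of potential at least B = ℓ + (n − 4) relative to the capture vertex.  Starting all three
-- robbers together at potential n − 4 gives (n − 4) + 2B = 2ℓ + 3 (n − 4) rounds.
module Submission where

open import Defs
open import Data.Nat using (ℕ; zero; suc; _+_; _*_; _∸_; _/_; _%_; _≤_; _<_; z≤n; s≤s; _≤?_; _<?_)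
import Data.Nat as ℕ
open import Data.Nat.Properties hiding (_≟_)
open import Algebra.Properties.CommutativeSemigroup +-commutativeSemigroup using (x∙yz≈y∙xz)
open import Data.Nat.DivMod using (/-monoˡ-≤; m/n≡1+[m∸n]/n; m*n/n≡m; [m+kn]%n≡m%n)
open import Data.Nat.Tactic.RingSolver using (solve; solve-∀)
open import Data.Fin using (Fin; _≟_; toℕ; fromℕ<)
import Data.Fin as Fin
open import Data.Fin.Properties using (toℕ-injective; toℕ<n; toℕ-fromℕ<; any?) renaming (suc-injective to fsuc-injective)
open import Data.List using (_∷_; [])
open import Data.Maybe using (just; nothing)
open import Data.Maybe.Properties using (just-injective)
import Data.Maybe.Properties as Maybe
open import Data.Vec using (Vec; map; lookup; tabulate; replicate)
open import Data.Vec.Properties using (lookup∘tabulate; lookup-map; lookup-replicate)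
open import Data.Product using (Σ; _×_; _,_; proj₁; proj₂)
open import Data.Sum using (_⊎_; inj₁; inj₂)
open import Data.Unit using (⊤; tt)
open import Function using (_∘_)
open import Relation.Binary.Definitions using (Decidable; DecidableEquality; tri<; tri≈; tri>)
open import Relation.Nullary using (¬_; yes; no; contradiction)
open import Relation.Nullary.Decidable using (True; toWitness; map′; _⊎-dec_; _×-dec_)
open import Relation.Binary.PropositionalEquality

lit≤ : ∀ a b {c} {a≤b : True (a ≤? b)} → a + c ≤ b + c
lit≤ a b {c} {a≤b} = +-monoˡ-≤ c (toWitness a≤b)

-- Cop-and-robber games

module GameFacts {V : Set} (Adj : V → V → Set) (_≟_ : DecidableEquality V)
                 (stay : ∀ {x} → Adj x x) where
  open import Data.Fin using (zero; suc)
  open import Data.Vec using ([]; _∷_)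
  open Game Adj _≟_

  catch-hit : ∀ c → catch c (just c) ≡ nothing
  catch-hit c with c ≟ c
  ... | yes _   = refl
  ... | no c≢c = contradiction refl c≢c

  catch-miss : ∀ {c r} → r ≢ c → catch c (just r) ≡ just r
  catch-miss {c} {r} r≢c with r ≟ c
  ... | yes r≡c = contradiction r≡c r≢c
  ... | no _    = refl

  captured∷ : ∀ {m} {xs : Vec Robber m} → AllCaptured xs → AllCaptured (nothing ∷ xs)
  captured∷ = _∷_

  AllCaptured-step : ∀ {m} {xs ys : Vec Robber m} c c' →
                     AllCaptured xs → Steps (catchAll c xs) ys → AllCaptured (catchAll c' ys)
  AllCaptured-step c c' []       []           = []
  AllCaptured-step c c' (_∷_ ac) (dead ∷ sts) = captured∷ (AllCaptured-step c c' ac sts)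

  Win-suc : ∀ {m} k c {xs : Vec Robber m} → Win k c xs → Win (suc k) c xs
  Win-suc zero    c ac           = c , stay , λ _ sts → AllCaptured-step c c ac sts
  Win-suc (suc k) c (c' , a , w) = c' , a , λ ys sts → Win-suc k c' (w ys sts)

  Win-captured∷ : ∀ {m} k c {xs : Vec Robber m} → Win k c xs → Win k c (nothing ∷ xs)
  Win-captured∷ zero    c ac           = captured∷ ac
  Win-captured∷ (suc k) c (c' , a , w) = c' , a , response
    where
      response : ∀ ys → Steps (catchAll c' (nothing ∷ _)) ys → Win k c' (catchAll c' ys)
      response (nothing ∷ ys) (dead ∷ sts) = Win-captured∷ k c' (w ys sts)

  Win-captured : ∀ k c → Win k c (nothing ∷ [])
  Win-captured zero    c = captured∷ []
  Win-captured (suc k) c = c , stay , response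
    where
      response : ∀ ys → Steps (catchAll c (nothing ∷ [])) ys → Win k c (catchAll c ys)
      response (nothing ∷ []) (dead ∷ []) = Win-captured k c

  Win-sequence : ∀ {m} a b c y (xs : Vec Robber m) → Win a c (y ∷ []) →
                 (∀ c' (ys : Vec Robber m) → Win b c' (catchAll c' ys)) →
                 Win (a + b) c (y ∷ catchAll c xs)
  Win-sequence zero    b c nothing xs (_∷_ []) rest = Win-captured∷ b c (rest c xs)
  Win-sequence (suc a) b c y       xs (c' , adj , w) rest = c' , adj , response
    where
      response : ∀ zs → Steps (catchAll c' (y ∷ catchAll c xs)) zs → Win (a + b) c' (catchAll c' zs)
      response (z ∷ zs) (st ∷ sts) = Win-sequence a b c' (catch c' z) zs (w (z ∷ []) (st ∷ [])) rest

  Steps-pointwise : ∀ {m} {xs ys : Vec Robber m} → (∀ i → Step (lookup xs i) (lookup ys i)) → Steps xs ys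
  Steps-pointwise {xs = []}     {[]}     st = []
  Steps-pointwise {xs = x ∷ xs} {y ∷ ys} st = st zero ∷ Steps-pointwise (λ i → st (suc i))

  catchAll-avoiding : ∀ {m} c {ys : Vec Robber m} → (∀ i → lookup ys i ≢ just c) → catchAll c ys ≡ ys
  catchAll-avoiding c {[]}           avoid = refl
  catchAll-avoiding c {nothing ∷ ys} avoid = cong (nothing ∷_) (catchAll-avoiding c (λ i → avoid (suc i)))
  catchAll-avoiding c {just y ∷ ys}  avoid =
    cong₂ _∷_ (catch-miss (λ y≡c → avoid zero (cong just y≡c))) (catchAll-avoiding c (λ i → avoid (suc i)))

  isAlive : Robber → ℕ
  isAlive nothing  = 0
  isAlive (just _) = 1

  #alive : ∀ {m} → Vec Robber m → ℕ
  #alive []       = 0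
  #alive (x ∷ xs) = isAlive x + #alive xs

  AllCaptured⇒#alive≡0 : ∀ {m} {xs : Vec Robber m} → AllCaptured xs → #alive xs ≡ 0
  AllCaptured⇒#alive≡0 []        = refl
  AllCaptured⇒#alive≡0 (_∷_ ac) = AllCaptured⇒#alive≡0 ac

  #alive-pointwise : ∀ {m} (xs ys : Vec Robber m) →
                    (∀ i → isAlive (lookup ys i) ≡ isAlive (lookup xs i)) → #alive ys ≡ #alive xs
  #alive-pointwise []       []       same = refl
  #alive-pointwise (x ∷ xs) (y ∷ ys) same = cong₂ _+_ (same zero) (#alive-pointwise xs ys (λ i → same (suc i)))

  #alive-capture : ∀ {m} (xs ys : Vec Robber m) j → lookup ys j ≡ nothing →
                  (∀ i → i ≢ j → isAlive (lookup ys i) ≡ isAlive (lookup xs i)) →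
                  #alive xs ≡ isAlive (lookup xs j) + #alive ys
  #alive-capture (x ∷ xs) (.nothing ∷ ys) zero refl same =
    cong (isAlive x +_) (sym (#alive-pointwise xs ys (λ i → same (suc i) (λ ()))))
  #alive-capture (x ∷ xs) (y ∷ ys) (suc j) yj≡nothing same = begin
    isAlive x + #alive xs
      ≡⟨ cong₂ _+_ (sym (same zero (λ ()))) IH ⟩
    isAlive y + (isAlive (lookup xs j) + #alive ys)
      ≡⟨ x∙yz≈y∙xz (isAlive y) (isAlive (lookup xs j)) (#alive ys) ⟩
    isAlive (lookup xs j) + (isAlive y + #alive ys)
      ∎
    where
      open ≡-Reasoning
      IH = #alive-capture xs ys j yj≡nothing (λ i i≢j → same (suc i) (λ si≡sj → i≢j (fsuc-injective si≡sj)))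

  module _ {m} (Safe : ℕ → V → Vec Robber m → Set)
           (not-captured : ∀ {c xs} → Safe 0 c xs → ¬ AllCaptured xs)
           (evade : ∀ {t c xs} → Safe (suc t) c xs → ∀ c' → Adj c c' →
                    Σ (Vec Robber m) λ ys → Steps (catchAll c' xs) ys ×
                      (∀ i → lookup ys i ≢ just c') × Safe t c' ys) where

    Safe⇒¬Win : ∀ t c xs → Safe t c xs → ¬ Win t c xs
    Safe⇒¬Win zero    c xs safe captured = not-captured safe captured
    Safe⇒¬Win (suc t) c xs safe (c' , adj , w) with evade safe c' adj
    ... | ys , sts , avoid , safe' =
      Safe⇒¬Win t c' ys safe' (subst (Win t c') (catchAll-avoiding c' avoid) (w ys sts))

-- The graph H(n)

-- The edges of H(n) join exactly the labels that differ by 1, 3 or 4, plus the pair {1, 3};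
-- Edge omits the bound n, which the vertex type Fin n supplies.
data Edge : ℕ → ℕ → Set where
  diff1  : ∀ b → Edge (1 + b) b
  diff3  : ∀ b → Edge (3 + b) b
  diff4  : ∀ b → Edge (4 + b) b
  edge31 : Edge 3 1

Adj : ℕ → ℕ → Set
Adj x y = x ≡ y ⊎ Edge x y ⊎ Edge y x

Adj-sym : ∀ {x y} → Adj x y → Adj y x
Adj-sym (inj₁ x≡y)        = inj₁ (sym x≡y)
Adj-sym (inj₂ (inj₁ e)) = inj₂ (inj₂ e)
Adj-sym (inj₂ (inj₂ e)) = inj₂ (inj₁ e)

stay : ∀ {x} → Adj x x
stay = inj₁ refl

↓1 : ∀ {x y} → x ≡ 1 + y → Adj x y
↓1 refl = inj₂ (inj₁ (diff1 _))

↓3 : ∀ {x y} → x ≡ 3 + y → Adj x y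
↓3 refl = inj₂ (inj₁ (diff3 _))

↓4 : ∀ {x y} → x ≡ 4 + y → Adj x y
↓4 refl = inj₂ (inj₁ (diff4 _))

↑1 : ∀ {x y} → y ≡ 1 + x → Adj x y
↑1 refl = inj₂ (inj₂ (diff1 _))

↑3 : ∀ {x y} → y ≡ 3 + x → Adj x y
↑3 refl = inj₂ (inj₂ (diff3 _))

↑4 : ∀ {x y} → y ≡ 4 + x → Adj x y
↑4 refl = inj₂ (inj₂ (diff4 _))

adj13 : Adj 1 3
adj13 = inj₂ (inj₂ edge31)

data EdgeView (x y : ℕ) : Set where
  by1  : x ≡ 1 + y → EdgeView x y
  by3  : x ≡ 3 + y → EdgeView x y
  by4  : x ≡ 4 + y → EdgeView x y
  by31 : x ≡ 3 → y ≡ 1 → EdgeView x y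

edgeView : ∀ {x y} → Edge x y → EdgeView x y
edgeView (diff1 _) = by1 refl
edgeView (diff3 _) = by3 refl
edgeView (diff4 _) = by4 refl
edgeView edge31    = by31 refl refl

edge? : Decidable Edge
edge? x y = map′ fromSum toSum
  (x ℕ.≟ 1 + y ⊎-dec x ℕ.≟ 3 + y ⊎-dec x ℕ.≟ 4 + y ⊎-dec (x ℕ.≟ 3 ×-dec y ℕ.≟ 1))
  where
    fromSum : x ≡ 1 + y ⊎ x ≡ 3 + y ⊎ x ≡ 4 + y ⊎ (x ≡ 3 × y ≡ 1) → Edge x y
    fromSum (inj₁ refl)                      = diff1 y
    fromSum (inj₂ (inj₁ refl))               = diff3 y
    fromSum (inj₂ (inj₂ (inj₁ refl)))        = diff4 y
    fromSum (inj₂ (inj₂ (inj₂ (refl , refl)))) = edge31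
    toSum : Edge x y → x ≡ 1 + y ⊎ x ≡ 3 + y ⊎ x ≡ 4 + y ⊎ (x ≡ 3 × y ≡ 1)
    toSum (diff1 _) = inj₁ refl
    toSum (diff3 _) = inj₂ (inj₁ refl)
    toSum (diff4 _) = inj₂ (inj₂ (inj₁ refl))
    toSum edge31    = inj₂ (inj₂ (inj₂ (refl , refl)))

adj? : Decidable Adj
adj? x y = x ℕ.≟ y ⊎-dec edge? x y ⊎-dec edge? y x

label : ∀ {n} → Fin n → ℕ
label i = suc (toℕ i)

label-injective : ∀ {n} {i j : Fin n} → label i ≡ label j → i ≡ j
label-injective eq = toℕ-injective (suc-injective eq)

label≥1 : ∀ {n} (i : Fin n) → 1 ≤ label i
label≥1 i = s≤s z≤n

label≤n : ∀ {n} (i : Fin n) → label i ≤ n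
label≤n = toℕ<n

vertex : ∀ {n} x → 1 ≤ x → x ≤ n → Σ (Fin n) λ i → label i ≡ x
vertex (suc x) _ x<n = fromℕ< x<n , cong suc (toℕ-fromℕ< x<n)

Edge⇒HEdge : ∀ {a b} → Edge a (suc b) → HEdge a (suc b)
Edge⇒HEdge {b = 0} (diff1 _) = e21
Edge⇒HEdge {b = 1} (diff1 _) = e32
Edge⇒HEdge {b = 2} (diff1 _) = e43
Edge⇒HEdge {b = 3} (diff1 _) = e54
Edge⇒HEdge {b = 4} (diff1 _) = e65
Edge⇒HEdge {b = 5} (diff1 _) = e76
Edge⇒HEdge {b = suc (suc (suc (suc (suc (suc k)))))} (diff1 _) = ext1 k
Edge⇒HEdge {b = 0} (diff3 _) = e41
Edge⇒HEdge {b = 1} (diff3 _) = e52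
Edge⇒HEdge {b = 2} (diff3 _) = e63
Edge⇒HEdge {b = 3} (diff3 _) = e74
Edge⇒HEdge {b = suc (suc (suc (suc k)))} (diff3 _) = ext3 k
Edge⇒HEdge {b = 0} (diff4 _) = e51
Edge⇒HEdge {b = 1} (diff4 _) = e62
Edge⇒HEdge {b = 2} (diff4 _) = e73
Edge⇒HEdge {b = suc (suc (suc k))} (diff4 _) = ext4 k
Edge⇒HEdge edge31 = e31

HEdge⇒Edge : ∀ {a b} → HEdge a b → Edge a b
HEdge⇒Edge e62 = diff4 2
HEdge⇒Edge e21 = diff1 1
HEdge⇒Edge e41 = diff3 1
HEdge⇒Edge e65 = diff1 5
HEdge⇒Edge e52 = diff3 2
HEdge⇒Edge e51 = diff4 1
HEdge⇒Edge e54 = diff1 4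
HEdge⇒Edge e63 = diff3 3
HEdge⇒Edge e32 = diff1 2
HEdge⇒Edge e31 = edge31
HEdge⇒Edge e43 = diff1 3
HEdge⇒Edge e76 = diff1 6
HEdge⇒Edge e74 = diff3 4
HEdge⇒Edge e73 = diff4 3
HEdge⇒Edge (ext1 k) = diff1 (7 + k)
HEdge⇒Edge (ext3 k) = diff3 (5 + k)
HEdge⇒Edge (ext4 k) = diff4 (4 + k)

Adj⇒HAdj : ∀ {n} {i j : Fin n} → Adj (label i) (label j) → HAdj n i j
Adj⇒HAdj (inj₁ eq)        = inj₁ (label-injective eq)
Adj⇒HAdj (inj₂ (inj₁ e)) = inj₂ (inj₁ (Edge⇒HEdge e))
Adj⇒HAdj (inj₂ (inj₂ e)) = inj₂ (inj₂ (Edge⇒HEdge e))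

HAdj⇒Adj : ∀ {n} {i j : Fin n} → HAdj n i j → Adj (label i) (label j)
HAdj⇒Adj (inj₁ refl)      = stay
HAdj⇒Adj (inj₂ (inj₁ e)) = inj₂ (inj₁ (HEdge⇒Edge e))
HAdj⇒Adj (inj₂ (inj₂ e)) = inj₂ (inj₂ (HEdge⇒Edge e))

Edge⇒< : ∀ {x y} → Edge x y → y < x
Edge⇒< (diff1 y) = ≤-refl
Edge⇒< (diff3 y) = m≤n+m (suc y) 2
Edge⇒< (diff4 y) = m≤n+m (suc y) 3
Edge⇒< edge31    = lit≤ 2 3

-- Upper bound

-- In round j the cop heads for c: the robber itself, or a vertex 4q + 4 below it with
-- j − 3 ≤ c ≤ j.  Since j plus the number of rounds left is N, the second case is impossible
-- once no round is left.
data Shadow (j c r : ℕ) : Set where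
  onto  : c ≡ r → c ≤ j → Shadow j c r
  below : ∀ q → r ≡ 4 + 4 * q + c → c ≤ j → j ≤ 3 + c → Shadow j c r

ShadowMove : ℕ → ℕ → ℕ → Set
ShadowMove j c r' = Σ ℕ λ c' → Adj c c' × Shadow (suc j) c' r'

aligned : ∀ {j c r} q → r ≡ 4 * q + c → c ≤ j × j ≤ 3 + c → Shadow j c r
aligned         zero    refl (c≤j , _)      = onto refl c≤j
aligned {c = c} (suc q) r≡   (c≤j , j≤3+c) = below q (trans r≡ (cong (_+ c) (*-suc 4 q))) c≤j j≤3+c

≤2-or-3 : ∀ {t} → t ≤ 3 → t ≤ 2 ⊎ t ≡ 3
≤2-or-3 {t} t≤3 with t ≤? 2
... | yes t≤2 = inj₁ t≤2
... | no t≰2  = inj₂ (≤-antisym t≤3 (≰⇒> t≰2))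

≤1-or-≥2 : ∀ t → t ≤ 1 ⊎ 2 ≤ t
≤1-or-≥2 t with t ≤? 1
... | yes t≤1 = inj₁ t≤1
... | no t≰1  = inj₂ (≰⇒> t≰1)

window-keep : ∀ t c → t ≤ 2 → c ≤ suc (t + c) × suc (t + c) ≤ 3 + c
window-keep t c t≤2 = ≤-trans (m≤n+m c t) (n≤1+n _) , +-monoˡ-≤ c (s≤s t≤2)

window-up1 : ∀ t c → t ≤ 3 → suc c ≤ suc (t + c) × suc (t + c) ≤ 3 + suc c
window-up1 t c t≤3 = s≤s (m≤n+m c t) , +-monoˡ-≤ c (s≤s t≤3)

window-up3 : ∀ t c → 2 ≤ t → t ≤ 3 → 3 + c ≤ suc (t + c) × suc (t + c) ≤ 3 + (3 + c)
window-up3 t c 2≤t t≤3 = +-monoˡ-≤ c (s≤s 2≤t) , +-monoˡ-≤ c (≤-trans (s≤s t≤3) (lit≤ 4 6))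

window-up4 : ∀ c → 4 + c ≤ suc (3 + c) × suc (3 + c) ≤ 3 + (4 + c)
window-up4 c = ≤-refl , lit≤ 4 7

window-down1 : ∀ t c → t ≤ 1 → c ≤ suc (t + suc c) × suc (t + suc c) ≤ 3 + c
window-down1 t c t≤1 =
  m≤n⇒m≤1+n (≤-trans (n≤1+n c) (m≤n+m (suc c) t)) ,
  subst (_≤ 3 + c) (cong suc (sym (+-suc t c))) (+-monoˡ-≤ c (s≤s (s≤s t≤1)))

no-room-below : ∀ t → t ≤ 1 → ¬ 4 ≤ t + 0
no-room-below t t≤1 4≤t = <⇒≱ (≤-trans (lit≤ 2 4) 4≤t) (subst (_≤ 1) (sym (+-identityʳ t)) t≤1)

trail-stay : ∀ t c q → t ≤ 3 → ShadowMove (t + c) c (4 + 4 * q + c)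
trail-stay t c q t≤3 with ≤2-or-3 t≤3
... | inj₁ t≤2 = c , stay , aligned (suc q) (solve (q ∷ c ∷ [])) (window-keep t c t≤2)
... | inj₂ refl = 4 + c , ↑4 refl , aligned q (solve (q ∷ c ∷ [])) (window-up4 c)

trail-↑1 : ∀ t c q → t ≤ 3 → ShadowMove (t + c) c (1 + (4 + 4 * q + c))
trail-↑1 t c q t≤3 = suc c , ↑1 refl , aligned (suc q) (solve (q ∷ c ∷ [])) (window-up1 t c t≤3)

trail-↑3 : ∀ t c q → t ≤ 3 → 4 ≤ t + c → ShadowMove (t + c) c (3 + (4 + 4 * q + c))
trail-↑3 t c q t≤3 4≤j with ≤1-or-≥2 t
trail-↑3 t (suc c) q _ _ | inj₁ t≤1 = c , ↓1 refl , aligned (2 + q) (solve (q ∷ c ∷ [])) (window-down1 t c t≤1)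
trail-↑3 t zero q _ 4≤j | inj₁ t≤1 = contradiction 4≤j (no-room-below t t≤1)
trail-↑3 t c q t≤3 _ | inj₂ 2≤t = 3 + c , ↑3 refl , aligned (suc q) (solve (q ∷ c ∷ [])) (window-up3 t c 2≤t t≤3)

trail-↑4 : ∀ t c q → t ≤ 3 → ShadowMove (t + c) c (4 + (4 + 4 * q + c))
trail-↑4 t c q t≤3 with ≤2-or-3 t≤3
... | inj₁ t≤2 = c , stay , aligned (2 + q) (solve (q ∷ c ∷ [])) (window-keep t c t≤2)
... | inj₂ refl = 4 + c , ↑4 refl , aligned (suc q) (solve (q ∷ c ∷ [])) (window-up4 c)

trail-↓1 : ∀ t c q → t ≤ 3 → 4 ≤ t + c → ShadowMove (t + c) c (3 + 4 * q + c)
trail-↓1 t c q t≤3 4≤j with ≤1-or-≥2 t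
trail-↓1 t (suc c) q _ _ | inj₁ t≤1 = c , ↓1 refl , aligned (suc q) (solve (q ∷ c ∷ [])) (window-down1 t c t≤1)
trail-↓1 t zero q _ 4≤j | inj₁ t≤1 = contradiction 4≤j (no-room-below t t≤1)
trail-↓1 t c q t≤3 _ | inj₂ 2≤t = 3 + c , ↑3 refl , aligned q (solve (q ∷ c ∷ [])) (window-up3 t c 2≤t t≤3)

trail-↓3 : ∀ t c q → t ≤ 3 → ShadowMove (t + c) c (1 + 4 * q + c)
trail-↓3 t c q t≤3 = suc c , ↑1 refl , aligned q (solve (q ∷ c ∷ [])) (window-up1 t c t≤3)

trail-↓4 : ∀ t c q → t ≤ 3 → ShadowMove (t + c) c (4 * q + c)
trail-↓4 t c q t≤3 with ≤2-or-3 t≤3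
... | inj₁ t≤2 = c , stay , aligned q refl (window-keep t c t≤2)
trail-↓4 _ c zero    _ | inj₂ refl = c , stay , onto refl (m≤n⇒m≤1+n (m≤n+m c 3))
trail-↓4 _ c (suc q) _ | inj₂ refl = 4 + c , ↑4 refl , aligned q (solve (q ∷ c ∷ [])) (window-up4 c)

trail-step : ∀ t c q r' → t ≤ 3 → 4 ≤ t + c → Adj (4 + 4 * q + c) r' → ShadowMove (t + c) c r'
trail-step t c q _ t≤3 _   (inj₁ refl)             = trail-stay t c q t≤3
trail-step t c q _ t≤3 _   (inj₂ (inj₂ (diff1 _))) = trail-↑1 t c q t≤3
trail-step t c q _ t≤3 4≤j (inj₂ (inj₂ (diff3 _))) = trail-↑3 t c q t≤3 4≤j
trail-step t c q _ t≤3 _   (inj₂ (inj₂ (diff4 _))) = trail-↑4 t c q t≤3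
trail-step t c q _ t≤3 4≤j (inj₂ (inj₁ (diff1 _))) = trail-↓1 t c q t≤3 4≤j
trail-step t c q _ t≤3 _   (inj₂ (inj₁ (diff3 _))) = trail-↓3 t c q t≤3
trail-step t c q _ t≤3 _   (inj₂ (inj₁ (diff4 _))) = trail-↓4 t c q t≤3

onto-step : ∀ j r r' → 4 ≤ j → r ≤ j → Adj r r' → ShadowMove j r r'
onto-step j r r' _ _ r~r' with r' ≤? suc j
... | yes r'≤1+j = r' , r~r' , onto refl r'≤1+j
onto-step j r _ _ r≤j (inj₁ refl) | no r'≰1+j = contradiction (m≤n⇒m≤1+n r≤j) r'≰1+j
onto-step j r _ _ r≤j (inj₂ (inj₁ e)) | no r'≰1+j =
  contradiction (≤-trans (<⇒≤ (Edge⇒< e)) (m≤n⇒m≤1+n r≤j)) r'≰1+j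
onto-step j r _ _ r≤j (inj₂ (inj₂ (diff1 _))) | no r'≰1+j = contradiction (s≤s r≤j) r'≰1+j
onto-step j 0 _ 4≤j _ (inj₂ (inj₂ (diff3 _))) | no r'≰1+j =
  contradiction (≤-trans (lit≤ 3 4) (m≤n⇒m≤1+n 4≤j)) r'≰1+j
onto-step j (suc r) _ _ r≤j (inj₂ (inj₂ (diff3 _))) | no r'≰1+j =
  r , ↓1 refl , below 0 refl (m≤n⇒m≤1+n (≤-trans (n≤1+n r) r≤j)) (≤-pred (≰⇒> r'≰1+j))
onto-step j r _ _ r≤j (inj₂ (inj₂ (diff4 _))) | no r'≰1+j =
  r , stay , below 0 refl (m≤n⇒m≤1+n r≤j) (≤-pred (≰⇒> r'≰1+j))
onto-step j _ _ 4≤j _ (inj₂ (inj₂ edge31)) | no r'≰1+j =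
  contradiction (≤-trans (lit≤ 3 4) (m≤n⇒m≤1+n 4≤j)) r'≰1+j

shadow-step : ∀ {j c r r'} → 4 ≤ j → Shadow j c r → Adj r r' → ShadowMove j c r'
shadow-step {j} {c} {r' = r'} 4≤j (onto refl c≤j) r~r' = onto-step j c r' 4≤j c≤j r~r'
shadow-step {j} {c} {r' = r'} 4≤j (below q refl c≤j j≤3+c) r~r' with m≤n⇒∃[o]m+o≡n c≤j
... | t , refl = subst (λ x → ShadowMove x c r') (+-comm t c)
                   (trail-step t c q r' (+-cancelʳ-≤ c t 3 t+c≤3+c) (subst (4 ≤_) (+-comm c t) 4≤j) r~r')
  where
    t+c≤3+c : t + c ≤ 3 + c
    t+c≤3+c = subst (_≤ 3 + c) (+-comm c t) j≤3+c

shadow-start : ∀ j r → 4 ≤ j → Σ ℕ λ c → Shadow j c r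
shadow-start j r 4≤j with r ≤? j
... | yes r≤j = r , onto refl r≤j
shadow-start j (suc (suc (suc (suc r)))) 4≤j | no r≰j with shadow-start j r 4≤j
... | c , onto refl c≤j          = c , below 0 refl c≤j (≤-pred (≰⇒> r≰j))
... | c , below q refl c≤j j≤3+c = c , below (suc q) (solve (q ∷ c ∷ [])) c≤j j≤3+c
shadow-start j 0 4≤j | no r≰j = contradiction z≤n r≰j
shadow-start j 1 4≤j | no r≰j = contradiction (≤-trans (lit≤ 1 4) 4≤j) r≰j
shadow-start j 2 4≤j | no r≰j = contradiction (≤-trans (lit≤ 2 4) 4≤j) r≰j
shadow-start j 3 4≤j | no r≰j = contradiction (≤-trans (lit≤ 3 4) 4≤j) r≰j

shadow-bounds : ∀ {j c r} → 4 ≤ j → 1 ≤ r → Shadow j c r → 1 ≤ c × c ≤ r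
shadow-bounds _   1≤r (onto refl _) = 1≤r , ≤-refl
shadow-bounds {c = c} 4≤j _ (below q refl _ j≤3+c) =
  +-cancelˡ-≤ 3 1 c (≤-trans 4≤j j≤3+c) , m≤n+m c (4 + 4 * q)

shadow-top : ∀ {j c r} → Shadow j c r → c ≤ j
shadow-top (onto _ c≤j)      = c≤j
shadow-top (below _ _ c≤j _) = c≤j

1-adj-≤5 : ∀ x → 1 ≤ x → x ≤ 5 → Adj 1 x
1-adj-≤5 1 _ _ = stay
1-adj-≤5 2 _ _ = ↑1 refl
1-adj-≤5 3 _ _ = adj13
1-adj-≤5 4 _ _ = ↑3 refl
1-adj-≤5 5 _ _ = ↑4 refl
1-adj-≤5 (suc (suc (suc (suc (suc (suc x)))))) _ (s≤s (s≤s (s≤s (s≤s (s≤s ())))))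

2-adj-≤5 : ∀ x → 1 ≤ x → x ≤ 5 → x ≢ 4 → Adj 2 x
2-adj-≤5 1 _ _ _ = ↓1 refl
2-adj-≤5 2 _ _ _ = stay
2-adj-≤5 3 _ _ _ = ↑1 refl
2-adj-≤5 4 _ _ x≢4 = contradiction refl x≢4
2-adj-≤5 5 _ _ _ = ↑3 refl
2-adj-≤5 (suc (suc (suc (suc (suc (suc x)))))) _ (s≤s (s≤s (s≤s (s≤s (s≤s ()))))) _

4-adj⇒1-adj : ∀ x → x ≤ 6 → Adj 4 x → Adj 1 x
4-adj⇒1-adj _ _ (inj₁ refl)                = ↑3 refl
4-adj⇒1-adj _ _ (inj₂ (inj₁ (diff1 _)))    = adj13
4-adj⇒1-adj _ _ (inj₂ (inj₁ (diff3 _)))    = stay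
4-adj⇒1-adj _ _ (inj₂ (inj₁ (diff4 _)))    = ↓1 refl
4-adj⇒1-adj _ _ (inj₂ (inj₂ (diff1 _)))    = ↑4 refl
4-adj⇒1-adj _ (s≤s (s≤s (s≤s (s≤s (s≤s (s≤s ())))))) (inj₂ (inj₂ (diff3 _)))
4-adj⇒1-adj _ (s≤s (s≤s (s≤s (s≤s (s≤s (s≤s ())))))) (inj₂ (inj₂ (diff4 _)))

step-down : ∀ w x → 4 * w + 2 < x → x ≤ 4 * suc w + 2 → Σ ℕ λ y → Adj x y × 1 ≤ y × y ≤ 4 * w + 2
step-down w 1 w<x _ = contradiction (≤-trans (lit≤ 1 2) (m≤n+m 2 (4 * w))) (<⇒≱ w<x)
step-down w 2 w<x _ = contradiction (m≤n+m 2 (4 * w)) (<⇒≱ w<x)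
step-down w 3 _ _ = 2 , ↓1 refl , s≤s z≤n , m≤n+m 2 (4 * w)
step-down w 4 _ _ = 1 , ↓3 refl , s≤s z≤n , ≤-trans (lit≤ 1 2) (m≤n+m 2 (4 * w))
step-down w (suc (suc (suc (suc (suc k))))) _ x≤ =
  suc k , ↓4 refl , s≤s z≤n , +-cancelˡ-≤ 4 (suc k) (4 * w + 2) (subst (5 + k ≤_) 4[1+w]+2≡4+[4w+2] x≤)
  where
    4[1+w]+2≡4+[4w+2] : 4 * suc w + 2 ≡ 4 + (4 * w + 2)
    4[1+w]+2≡4+[4w+2] = solve (w ∷ [])

three-phases : ∀ w m → m + ((w + m) + (w + m)) ≡ 2 * w + 3 * m
three-phases = solve-∀

module UpperBound (M : ℕ) where
  open import Data.Vec using ([]; _∷_)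

  N : ℕ
  N = 6 + M

  open Game (HAdj N) _≟_
  open GameFacts (HAdj N) _≟_ (inj₁ refl)

  shadow-vertex : ∀ {j} (c r : Fin N) → 4 ≤ j → (Σ ℕ λ c' → Adj (label c) c' × Shadow j c' (label r)) →
                  Σ (Fin N) λ c' → HAdj N c c' × Shadow j (label c') (label r)
  shadow-vertex c r 4≤j (c' , c~c' , sh) with shadow-bounds 4≤j (label≥1 r) sh
  ... | 1≤c' , c'≤r with vertex c' 1≤c' (≤-trans c'≤r (label≤n r))
  ...   | v , refl = v , Adj⇒HAdj c~c' , sh

  mutual
    shadowing-wins : ∀ i j (c c' r : Fin N) → j + i ≡ N → 4 ≤ j → HAdj N c c' →
                     Shadow j (label c') (label r) → Win (suc i) c (just r ∷ [])
    shadowing-wins i j c c' r j+i≡N 4≤j c~c' sh = c' , c~c' , response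
      where
        response : ∀ ys → Steps (catchAll c' (just r ∷ [])) ys → Win i c' (catchAll c' ys)
        response ys sts with r ≟ c'
        response (nothing ∷ []) (dead ∷ []) | yes _ = Win-captured i c'
        response (just r' ∷ []) (alive r~r' ∷ []) | no r≢c' =
          keep-shadowing i j c' r r' j+i≡N 4≤j sh r≢c' r~r'

    keep-shadowing : ∀ i j (c r r' : Fin N) → j + i ≡ N → 4 ≤ j → Shadow j (label c) (label r) → r ≢ c →
                     HAdj N r r' → Win i c (catch c (just r') ∷ [])
    keep-shadowing i j c r r' j+i≡N 4≤j (onto c≡r _) r≢c _ = contradiction (label-injective (sym c≡r)) r≢c
    keep-shadowing zero j c r r' j+0≡N 4≤j (below q r≡ _ j≤3+c) _ _ =
      contradiction (subst (label r ≤_) (trans (sym j+0≡N) (+-identityʳ j)) (label≤n r))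
                    (<⇒≱ (≤-trans (s≤s j≤3+c) (subst (4 + label c ≤_) (sym r≡) 4+c≤r)))
      where
        4+c≤r : 4 + label c ≤ 4 + 4 * q + label c
        4+c≤r = +-monoˡ-≤ (label c) (m≤m+n 4 (4 * q))
    keep-shadowing (suc i) j c r r' j+i≡N 4≤j (below q r≡ c≤j j≤3+c) r≢c r~r' with r' ≟ c
    ... | yes _ = Win-captured (suc i) c
    ... | no _ with shadow-vertex c r' (≤-trans 4≤j (n≤1+n j))
                      (shadow-step 4≤j (below q r≡ c≤j j≤3+c) (HAdj⇒Adj r~r'))
    ...   | c' , c~c' , sh' =
      shadowing-wins i (suc j) c c' r' (trans (sym (+-suc j i)) j+i≡N) (≤-trans 4≤j (n≤1+n j)) c~c' sh'

  v1 v2 : Fin N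
  v1 = Fin.zero
  v2 = Fin.suc Fin.zero

  catch-from-1 : ∀ x → Win (2 + M) v1 (catch v1 x ∷ [])
  catch-from-1 nothing = Win-captured (2 + M) v1
  catch-from-1 (just r) with r ≟ v1
  ... | yes _ = Win-captured (2 + M) v1
  ... | no _ with shadow-start 5 (label r) (lit≤ 4 5)
  ...   | c , sh with shadow-bounds (lit≤ 4 5) (label≥1 r) sh
  ...     | 1≤c , _ with shadow-vertex v1 r (lit≤ 4 5) (c , 1-adj-≤5 c 1≤c (shadow-top sh) , sh)
  ...       | c' , v1~c' , sh' = shadowing-wins (1 + M) 5 v1 c' r refl (lit≤ 4 5) v1~c' sh'

  catch-from-2 : ∀ x → Win (2 + M) v2 (catch v2 x ∷ [])
  catch-from-2 nothing = Win-captured (2 + M) v2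
  catch-from-2 (just r) with r ≟ v2
  ... | yes _ = Win-captured (2 + M) v2
  ... | no _ with shadow-start 5 (label r) (lit≤ 4 5)
  ...   | c , sh with shadow-bounds (lit≤ 4 5) (label≥1 r) sh | c ℕ.≟ 4
  ...     | 1≤c , _ | no c≢4 with shadow-vertex v2 r (lit≤ 4 5) (c , 2-adj-≤5 c 1≤c (shadow-top sh) c≢4 , sh)
  ...       | c' , v2~c' , sh' = shadowing-wins (1 + M) 5 v2 c' r refl (lit≤ 4 5) v2~c' sh'
  catch-from-2 (just r) | no _ | c , sh | _ | yes refl = v1 , Adj⇒HAdj (↓1 refl) , response
    where
      response : ∀ ys → Steps (catchAll v1 (just r ∷ [])) ys → Win (1 + M) v1 (catchAll v1 ys)
      response ys sts with r ≟ v1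
      response (nothing ∷ []) (dead ∷ []) | yes _ = Win-captured (1 + M) v1
      response (just r' ∷ []) (alive r~r' ∷ []) | no _ with r' ≟ v1
      ... | yes _ = Win-captured (1 + M) v1
      ... | no _ with shadow-step (lit≤ 4 5) sh (HAdj⇒Adj r~r')
      ...   | c₆ , 4~c₆ , sh₆
        with shadow-vertex v1 r' (lit≤ 4 6) (c₆ , 4-adj⇒1-adj c₆ (shadow-top sh₆) 4~c₆ , sh₆)
      ...     | c' , v1~c' , sh' = shadowing-wins M 6 v1 c' r' refl (lit≤ 4 6) v1~c' sh'

  descend : ∀ {m} w (c : Fin N) → label c ≤ 4 * w + 2 →
            (∀ x → Win m v1 (catch v1 x ∷ [])) → (∀ x → Win m v2 (catch v2 x ∷ [])) →
            ∀ x → Win (w + m) c (catch c x ∷ [])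
  descend zero Fin.zero _ from-1 _ = from-1
  descend zero (Fin.suc Fin.zero) _ _ from-2 = from-2
  descend zero (Fin.suc (Fin.suc c)) (s≤s (s≤s ())) _ _
  descend {m} (suc w) c c≤ from-1 from-2 x with label c ≤? 4 * w + 2
  ... | yes c≤′ = Win-suc (w + m) c (descend w c c≤′ from-1 from-2 x)
  ... | no c≰′ with step-down w (label c) (≰⇒> c≰′) c≤
  ...   | y , c~y , 1≤y , y≤ with vertex y 1≤y (≤-trans y≤ (<⇒≤ (≤-trans (≰⇒> c≰′) (label≤n c))))
  ...     | c' , refl = c' , Adj⇒HAdj c~y , response
    where
      response : ∀ ys → Steps (catchAll c' (catch c x ∷ [])) ys → Win (w + m) c' (catchAll c' ys)
      response (y ∷ []) _ = descend w c' y≤ from-1 from-2 y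

  capture-one : ∀ w → N ≤ 4 * w + 2 → ∀ c x → Win (w + (2 + M)) c (catch c x ∷ [])
  capture-one w N≤ c = descend w c (≤-trans (label≤n c) N≤) catch-from-1 catch-from-2

  capture-three : ∀ w → N ≤ 4 * w + 2 → CaptureBy 3 (2 * w + 3 * (2 + M))
  capture-three w N≤ =
    v1 , λ rs → subst (λ t → Win t v1 (catchAll v1 (map just rs))) (three-phases w (2 + M)) (three rs)
    where
      B = w + (2 + M)
      one : ∀ c (ys : Vec Robber 1) → Win B c (catchAll c ys)
      one c (y ∷ []) = capture-one w N≤ c y
      two : ∀ c (ys : Vec Robber 2) → Win (B + B) c (catchAll c ys)
      two c (y₁ ∷ y₂ ∷ []) = Win-sequence B B c (catch c y₁) (y₂ ∷ []) (capture-one w N≤ c y₁) one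
      three : ∀ (rs : Vec (Fin N) 3) → Win ((2 + M) + (B + B)) v1 (catchAll v1 (map just rs))
      three (r₀ ∷ r₁ ∷ r₂ ∷ []) =
        Win-sequence (2 + M) (B + B) v1 (catch v1 (just r₀)) (just r₁ ∷ just r₂ ∷ []) (catch-from-1 (just r₀)) two

capture-in-time : ∀ N w → 6 ≤ N → N ≤ 4 * w + 2 → Game.CaptureBy (HAdj N) _≟_ 3 (2 * w + 3 * (N ∸ 4))
capture-in-time N w 6≤N N≤ with N ∸ 6 | m+[n∸m]≡n 6≤N
... | M | refl = UpperBound.capture-three M w N≤

-- Lower bound

-- The number of moves the cop needs to walk from c down to {1, 2}.
descent : ℕ → ℕ
descent c = (c + 1) / 4

descent-mono : ∀ {x y} → x ≤ y → descent x ≤ descent y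
descent-mono x≤y = /-monoˡ-≤ 4 (+-monoˡ-≤ 1 x≤y)

descent-4+ : ∀ y → descent (4 + y) ≡ suc (descent y)
descent-4+ y = m/n≡1+[m∸n]/n (m≤m+n 4 (y + 1))

descent-step : ∀ {x y} → x ≤ 4 + y → descent x ≤ suc (descent y)
descent-step {x} {y} x≤4+y = subst (descent x ≤_) (descent-4+ y) (descent-mono x≤4+y)

descent-3+4m : ∀ m → descent (3 + 4 * m) ≡ suc m
descent-3+4m m = trans (cong (_/ 4) 3+4m+1≡[1+m]*4) (m*n/n≡m (suc m) 4)
  where
    3+4m+1≡[1+m]*4 : 3 + 4 * m + 1 ≡ suc m * 4
    3+4m+1≡[1+m]*4 = solve (m ∷ [])

descent-bound : ∀ m a → 4 * m + 2 ≤ a + 3 → m ≤ descent a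
descent-bound zero    a _ = z≤n
descent-bound (suc m) a bound = subst (_≤ descent a) (descent-3+4m m) (descent-mono 3+4m≤a)
  where
    4[1+m]+2≡3+4m+3 : 4 * suc m + 2 ≡ 3 + 4 * m + 3
    4[1+m]+2≡3+4m+3 = solve (m ∷ [])
    3+4m≤a : 3 + 4 * m ≤ a
    3+4m≤a = +-cancelʳ-≤ 3 (3 + 4 * m) a (subst (_≤ a + 3) 4[1+m]+2≡3+4m+3 bound)

descent+-step : ∀ a b X → a ≤ 4 + b → descent a + X ≤ suc (descent b + X)
descent+-step a b X a≤4+b = +-monoˡ-≤ X (descent-step a≤4+b)

descent+-mono : ∀ {a b} X → a ≤ b → descent a + X ≤ suc (descent b + X)
descent+-mono X a≤b = m≤n⇒m≤1+n (+-monoˡ-≤ X (descent-mono a≤b))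

m∸n≤1+m∸[1+n] : ∀ m n → m ∸ n ≤ suc (m ∸ suc n)
m∸n≤1+m∸[1+n] zero    zero    = z≤n
m∸n≤1+m∸[1+n] zero    (suc n) = z≤n
m∸n≤1+m∸[1+n] (suc m) zero    = ≤-refl
m∸n≤1+m∸[1+n] (suc m) (suc n) = m∸n≤1+m∸[1+n] m n

-- Positions of a robber r relative to the cop c that the robber can maintain; the cop needs at
-- least potential s more rounds to catch it.
data Shape (n c r : ℕ) : Set where
  below2        : c ≡ 2 + r → 2 ≤ r → c ≤ n → Shape n c r
  below5+       : ∀ k → c ≡ 5 + k + r → 1 ≤ r → c ≤ n → Shape n c r
  above4q+2     : ∀ q → r ≡ 2 + 4 * q + c → 2 ≤ c → r ≤ n → Shape n c r
  above4q+6-at1 : ∀ q → c ≡ 1 → r ≡ 7 + 4 * q → r ≤ n → Shape n c r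
  above4q+5     : ∀ q → r ≡ 5 + 4 * q + c → 1 ≤ c → r ≤ n → Shape n c r

potential : ∀ {n c r} → Shape n c r → ℕ
potential {n} {c} (below2 _ _ _)            = descent c + (n ∸ 4)
potential {n} {c} (below5+ _ _ _ _)         = descent c + (n ∸ 4)
potential {n} {c} (above4q+2 _ _ _ _)       = descent c + (n ∸ 4)
potential {n}     (above4q+6-at1 _ _ _ _)   = n ∸ 5
potential {n} {c} (above4q+5 _ _ _ _)       = n ∸ (3 + c)

Adj-gap : ∀ g x → Adj x (g + x) → g ≤ 4 × (g ≡ 2 → x ≡ 1)
Adj-gap zero    x (inj₁ _)           = z≤n , λ ()
Adj-gap (suc g) x (inj₁ x≡1+g+x)     = contradiction x≡1+g+x (m≢1+n+m x)
Adj-gap g       x (inj₂ (inj₁ e))    = contradiction (Edge⇒< e) (≤⇒≯ (m≤n+m x g))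
Adj-gap g       x (inj₂ (inj₂ e)) with edgeView e
... | by1 g+x≡1+x with +-cancelʳ-≡ x g 1 g+x≡1+x
...   | refl = lit≤ 1 4 , λ ()
Adj-gap g x (inj₂ (inj₂ e)) | by3 g+x≡3+x with +-cancelʳ-≡ x g 3 g+x≡3+x
...   | refl = lit≤ 3 4 , λ ()
Adj-gap g x (inj₂ (inj₂ e)) | by4 g+x≡4+x with +-cancelʳ-≡ x g 4 g+x≡4+x
...   | refl = ≤-refl , λ ()
Adj-gap g x (inj₂ (inj₂ e)) | by31 g+1≡3 refl with +-cancelʳ-≡ 1 g 2 g+1≡3
...   | refl = lit≤ 2 4 , λ _ → refl

1-adj⇒≤5 : ∀ {x} → Adj 1 x → x ≤ 5
1-adj⇒≤5 (inj₁ refl)             = lit≤ 1 5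
1-adj⇒≤5 (inj₂ (inj₁ (diff1 _))) = z≤n
1-adj⇒≤5 (inj₂ (inj₂ (diff1 _))) = lit≤ 2 5
1-adj⇒≤5 (inj₂ (inj₂ (diff3 _))) = lit≤ 4 5
1-adj⇒≤5 (inj₂ (inj₂ (diff4 _))) = ≤-refl
1-adj⇒≤5 (inj₂ (inj₂ edge31))    = lit≤ 3 5

Shape⇒¬Adj : ∀ {n c r} → Shape n c r → ¬ Adj c r
Shape⇒¬Adj {r = r} (below2 refl 2≤r _) c~r with proj₂ (Adj-gap 2 r (Adj-sym c~r)) refl
... | refl = contradiction 2≤r λ { (s≤s ()) }
Shape⇒¬Adj {r = r} (below5+ k refl _ _) c~r with proj₁ (Adj-gap (5 + k) r (Adj-sym c~r))
... | s≤s (s≤s (s≤s (s≤s ())))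
Shape⇒¬Adj {c = c} (above4q+2 zero refl 2≤c _) c~r with proj₂ (Adj-gap 2 c c~r) refl
... | refl = contradiction 2≤c λ { (s≤s ()) }
Shape⇒¬Adj {c = c} (above4q+2 (suc q) refl _ _) c~r =
  contradiction (subst (λ z → 2 + z ≤ 4) (*-suc 4 q) (proj₁ (Adj-gap (2 + 4 * suc q) c c~r)))
                λ { (s≤s (s≤s (s≤s (s≤s ())))) }
Shape⇒¬Adj (above4q+6-at1 q refl refl _) c~r with 1-adj⇒≤5 c~r
... | s≤s (s≤s (s≤s (s≤s (s≤s ()))))
Shape⇒¬Adj {c = c} (above4q+5 q refl _ _) c~r with proj₁ (Adj-gap (5 + 4 * q) c c~r)
... | s≤s (s≤s (s≤s (s≤s ())))

Shape-robber-bounds : ∀ {n c r} → Shape n c r → 1 ≤ r × r ≤ n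
Shape-robber-bounds (below2 refl 2≤r c≤n)        = ≤-trans (s≤s z≤n) 2≤r , ≤-trans (m≤n+m _ 2) c≤n
Shape-robber-bounds {r = r} (below5+ k refl 1≤r c≤n) = 1≤r , ≤-trans (m≤n+m r (5 + k)) c≤n
Shape-robber-bounds (above4q+2 q refl _ r≤n)     = s≤s z≤n , r≤n
Shape-robber-bounds (above4q+6-at1 q _ refl r≤n) = s≤s z≤n , r≤n
Shape-robber-bounds (above4q+5 q refl _ r≤n)     = s≤s z≤n , r≤n

module Escapes (ℓ : ℕ) (2≤ℓ : 2 ≤ ℓ) where

  n : ℕ
  n = 4 * ℓ + 2

  10≤n : 10 ≤ n
  10≤n = +-monoˡ-≤ 2 (*-monoʳ-≤ 4 2≤ℓ)

  small≤n : ∀ x {x≤10 : True (x ≤? 10)} → x ≤ n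
  small≤n x {x≤10} = ≤-trans (toWitness x≤10) 10≤n

  small≢n : ∀ x {x<10 : True (x <? 10)} → x ≢ n
  small≢n x {x<10} x≡n = <⇒≱ (toWitness x<10) (subst (10 ≤_) (sym x≡n) 10≤n)

  [a+4q]%4≡a%4 : ∀ a q → (a + 4 * q) % 4 ≡ a % 4
  [a+4q]%4≡a%4 a q = trans (cong (λ z → (a + z) % 4) (*-comm 4 q)) ([m+kn]%n≡m%n a q 4)

  n%4≡2 : n % 4 ≡ 2
  n%4≡2 = trans (cong (_% 4) (+-comm (4 * ℓ) 2)) ([a+4q]%4≡a%4 2 ℓ)

  odd≢n : ∀ a q → a % 4 ≢ 2 → a + 4 * q ≢ n
  odd≢n a q a≢2 a+4q≡n = a≢2 (trans (sym ([a+4q]%4≡a%4 a q)) (trans (cong (_% 4) a+4q≡n) n%4≡2))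

  lower≤n : ∀ {r y} k → r ≡ k + y → r ≤ n → y ≤ n
  lower≤n {y = y} k refl r≤n = ≤-trans (m≤n+m y k) r≤n

  n∸5≤n∸4 : n ∸ 5 ≤ n ∸ 4
  n∸5≤n∸4 = ∸-monoʳ-≤ n (n≤1+n 4)

  n∸[3+c]≤1+potential : ∀ c c' → 1 ≤ c → n ∸ (3 + c) ≤ suc (descent c' + (n ∸ 4))
  n∸[3+c]≤1+potential c c' 1≤c =
    m≤n⇒m≤1+n (≤-trans (∸-monoʳ-≤ n (+-monoʳ-≤ 3 1≤c)) (m≤n+m _ (descent c')))

  -- n − 4 dominates the closed neighbourhood of n: the one place where no Shape can be kept.
  Trapped : ℕ → ℕ → Set
  Trapped r c' = r ≡ n × c' + 4 ≡ n

  Escape : ℕ → ℕ → ℕ → Set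
  Escape c' r v = Σ ℕ λ y → Adj r y × Σ (Shape n c' y) λ s' → v ≤ suc (potential s')

  escape-above4q+2-↓ : ∀ c c' q → 2 ≤ c → 2 + 4 * q + c ≤ n → Edge c c' → 1 ≤ c' →
                      Escape c' (2 + 4 * q + c) (descent c + (n ∸ 4))
  escape-above4q+2-↓ _ _ zero _ _ (diff1 1) _ =
    7 , ↑3 refl , above4q+6-at1 0 refl refl (small≤n 7) , m∸n≤1+m∸[1+n] n 4
  escape-above4q+2-↓ _ _ (suc q) _ r≤n (diff1 1) _ =
    7 + 4 * q , ↓1 r≡1+y , above4q+6-at1 q refl refl (lower≤n 1 r≡1+y r≤n) , m∸n≤1+m∸[1+n] n 4
    where
      r≡1+y : 2 + 4 * suc q + 2 ≡ 1 + (7 + 4 * q)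
      r≡1+y = solve (q ∷ [])
  escape-above4q+2-↓ _ _ q _ r≤n (diff1 (suc (suc d))) _ =
    2 + 4 * q + (2 + d) , ↓1 r≡1+y , above4q+2 q refl (s≤s (s≤s z≤n)) (lower≤n 1 r≡1+y r≤n) ,
    descent+-step (3 + d) (2 + d) (n ∸ 4) (lit≤ 3 6)
    where
      r≡1+y : 2 + 4 * q + (3 + d) ≡ 1 + (2 + 4 * q + (2 + d))
      r≡1+y = solve (q ∷ d ∷ [])
  escape-above4q+2-↓ _ _ q _ r≤n (diff3 1) _ =
    2 + 4 * q + 4 , stay , above4q+5 q (solve (q ∷ [])) (s≤s z≤n) r≤n , ≤-refl
  escape-above4q+2-↓ _ _ q _ r≤n (diff3 (suc (suc d))) _ =
    2 + 4 * q + (2 + d) , ↓3 r≡3+y , above4q+2 q refl (s≤s (s≤s z≤n)) (lower≤n 3 r≡3+y r≤n) ,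
    descent+-step (5 + d) (2 + d) (n ∸ 4) (lit≤ 5 6)
    where
      r≡3+y : 2 + 4 * q + (5 + d) ≡ 3 + (2 + 4 * q + (2 + d))
      r≡3+y = solve (q ∷ d ∷ [])
  escape-above4q+2-↓ _ _ q _ r≤n (diff4 1) _ =
    6 + 4 * q , ↓1 r≡1+y , above4q+5 q (solve (q ∷ [])) (s≤s z≤n) (lower≤n 1 r≡1+y r≤n) , ≤-refl
    where
      r≡1+y : 2 + 4 * q + 5 ≡ 1 + (6 + 4 * q)
      r≡1+y = solve (q ∷ [])
  escape-above4q+2-↓ _ _ q _ r≤n (diff4 (suc (suc d))) _ =
    2 + 4 * q + (2 + d) , ↓4 r≡4+y , above4q+2 q refl (s≤s (s≤s z≤n)) (lower≤n 4 r≡4+y r≤n) ,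
    descent+-step (6 + d) (2 + d) (n ∸ 4) ≤-refl
    where
      r≡4+y : 2 + 4 * q + (6 + d) ≡ 4 + (2 + 4 * q + (2 + d))
      r≡4+y = solve (q ∷ d ∷ [])
  escape-above4q+2-↓ _ _ q _ r≤n edge31 _ =
    6 + 4 * q , ↑1 y≡1+r , above4q+5 q (solve (q ∷ [])) (s≤s z≤n) y≤n , ≤-refl
    where
      y≡1+r : 6 + 4 * q ≡ 1 + (2 + 4 * q + 3)
      y≡1+r = solve (q ∷ [])
      r≡5+4q : 2 + 4 * q + 3 ≡ 5 + 4 * q
      r≡5+4q = solve (q ∷ [])
      y≤n : 6 + 4 * q ≤ n
      y≤n = subst (_≤ n) (sym y≡1+r) (≤∧≢⇒< r≤n (λ r≡n → odd≢n 5 q (λ ()) (trans (sym r≡5+4q) r≡n)))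

  escape-above4q+2-↑ : ∀ c c' q → 2 ≤ c → 2 + 4 * q + c ≤ n → Edge c' c → c' ≤ n →
                      Escape c' (2 + 4 * q + c) (descent c + (n ∸ 4))
  escape-above4q+2-↑ c _ q 2≤c r≤n (diff1 _) _ with suc (2 + 4 * q + c) ≤? n
  ... | yes r+1≤n = suc (2 + 4 * q + c) , ↑1 refl , above4q+2 q (solve (q ∷ c ∷ [])) (m≤n⇒m≤1+n 2≤c) r+1≤n ,
                    descent+-mono (n ∸ 4) (n≤1+n c)
  escape-above4q+2-↑ 2 _ zero _ r≤n (diff1 _) _ | no r+1≰n =
    contradiction (≤-antisym r≤n (≤-pred (≰⇒> r+1≰n))) (small≢n 4)
  escape-above4q+2-↑ 1 _ zero (s≤s ()) _ (diff1 _) _ | no _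
  escape-above4q+2-↑ (suc (suc (suc d))) _ zero _ _ (diff1 _) c'≤n | no _ =
    2 + d , ↓3 refl , below2 refl (s≤s (s≤s z≤n)) c'≤n , descent+-mono (n ∸ 4) (n≤1+n (3 + d))
  escape-above4q+2-↑ c _ (suc q) 2≤c r≤n (diff1 _) _ | no _ =
    2 + 4 * q + suc c , ↓3 r≡3+y , above4q+2 q refl (m≤n⇒m≤1+n 2≤c) (lower≤n 3 r≡3+y r≤n) ,
    descent+-mono (n ∸ 4) (n≤1+n c)
    where
      r≡3+y : 2 + 4 * suc q + c ≡ 3 + (2 + 4 * q + suc c)
      r≡3+y = solve (q ∷ c ∷ [])
  escape-above4q+2-↑ c _ zero 2≤c _ (diff3 _) c'≤n =
    suc c , ↓1 refl , below2 refl (m≤n⇒m≤1+n 2≤c) c'≤n , descent+-mono (n ∸ 4) (m≤n+m c 3)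
  escape-above4q+2-↑ c _ (suc q) 2≤c r≤n (diff3 _) _ =
    2 + 4 * q + (3 + c) , ↓1 r≡1+y , above4q+2 q refl (≤-trans 2≤c (m≤n+m c 3)) (lower≤n 1 r≡1+y r≤n) ,
    descent+-mono (n ∸ 4) (m≤n+m c 3)
    where
      r≡1+y : 2 + 4 * suc q + c ≡ 1 + (2 + 4 * q + (3 + c))
      r≡1+y = solve (q ∷ c ∷ [])
  escape-above4q+2-↑ c _ zero 2≤c _ (diff4 _) c'≤n =
    2 + c , stay , below2 refl (≤-trans 2≤c (m≤n+m c 2)) c'≤n , descent+-mono (n ∸ 4) (m≤n+m c 4)
  escape-above4q+2-↑ c _ (suc q) 2≤c r≤n (diff4 _) _ =
    2 + 4 * suc q + c , stay , above4q+2 q (solve (q ∷ c ∷ [])) (≤-trans 2≤c (m≤n+m c 4)) r≤n ,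
    descent+-mono (n ∸ 4) (m≤n+m c 4)
  escape-above4q+2-↑ _ _ _ (s≤s ()) _ edge31 _

  escape-above4q+2 : ∀ c c' q → 2 ≤ c → 2 + 4 * q + c ≤ n → Adj c c' → 1 ≤ c' → c' ≤ n →
                     Escape c' (2 + 4 * q + c) (descent c + (n ∸ 4))
  escape-above4q+2 c _ q 2≤c r≤n (inj₁ refl) _ _ = 2 + 4 * q + c , stay , above4q+2 q refl 2≤c r≤n , n≤1+n _
  escape-above4q+2 c c' q 2≤c r≤n (inj₂ (inj₁ e)) 1≤c' c'≤n = escape-above4q+2-↓ c c' q 2≤c r≤n e 1≤c'
  escape-above4q+2 c c' q 2≤c r≤n (inj₂ (inj₂ e)) 1≤c' c'≤n = escape-above4q+2-↑ c c' q 2≤c r≤n e c'≤n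

  escape-at1 : ∀ c' q → 7 + 4 * q ≤ n → Adj 1 c' → 1 ≤ c' → c' ≤ n → Escape c' (7 + 4 * q) (n ∸ 5)
  escape-at1 _ q r≤n (inj₁ refl) _ _ = 7 + 4 * q , stay , above4q+6-at1 q refl refl r≤n , n≤1+n _
  escape-at1 _ q r≤n (inj₂ (inj₂ (diff1 _))) _ _ =
    8 + 4 * q , ↑1 refl , above4q+2 (suc q) (solve (q ∷ [])) (s≤s (s≤s z≤n)) (≤∧≢⇒< r≤n (odd≢n 7 q (λ ()))) ,
    m≤n⇒m≤1+n n∸5≤n∸4
  escape-at1 _ q r≤n (inj₂ (inj₂ (diff3 _))) _ _ =
    6 + 4 * q , ↓1 refl , above4q+2 q (solve (q ∷ [])) (s≤s (s≤s z≤n)) (lower≤n 1 refl r≤n) ,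
    m≤n⇒m≤1+n (m≤n⇒m≤1+n n∸5≤n∸4)
  escape-at1 _ q r≤n (inj₂ (inj₂ (diff4 _))) _ _ =
    7 + 4 * q , stay , above4q+2 q (solve (q ∷ [])) (s≤s (s≤s z≤n)) r≤n , m≤n⇒m≤1+n (m≤n⇒m≤1+n n∸5≤n∸4)
  escape-at1 _ q r≤n (inj₂ (inj₂ edge31)) _ _ =
    8 + 4 * q , ↑1 refl , above4q+5 q (solve (q ∷ [])) (s≤s z≤n) (≤∧≢⇒< r≤n (odd≢n 7 q (λ ()))) ,
    m∸n≤1+m∸[1+n] n 5
  escape-at1 _ _ _ (inj₂ (inj₁ (diff1 _))) () _

  escape-above4q+5-↓ : ∀ c c' q → 1 ≤ c → 5 + 4 * q + c ≤ n → Edge c c' → 1 ≤ c' →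
                      Escape c' (5 + 4 * q + c) (n ∸ (3 + c))
  escape-above4q+5-↓ _ _ q _ r≤n (diff1 1) _ =
    5 + 4 * q + 2 , stay , above4q+6-at1 q refl (solve (q ∷ [])) r≤n , n≤1+n _
  escape-above4q+5-↓ _ _ q _ r≤n (diff1 (suc (suc d))) _ =
    5 + 4 * q + (3 + d) , stay , above4q+2 (suc q) (solve (q ∷ d ∷ [])) (s≤s (s≤s z≤n)) r≤n ,
    n∸[3+c]≤1+potential (3 + d) (2 + d) (s≤s z≤n)
  escape-above4q+5-↓ _ d q _ r≤n (diff3 _) 1≤d =
    5 + 4 * q + d , ↓3 r≡3+y , above4q+5 q refl 1≤d (lower≤n 3 r≡3+y r≤n) ,
    m≤n⇒m≤1+n (∸-monoʳ-≤ n (m≤n+m (3 + d) 3))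
    where
      r≡3+y : 5 + 4 * q + (3 + d) ≡ 3 + (5 + 4 * q + d)
      r≡3+y = solve (q ∷ d ∷ [])
  escape-above4q+5-↓ _ d q _ r≤n (diff4 _) 1≤d =
    5 + 4 * q + d , ↓4 r≡4+y , above4q+5 q refl 1≤d (lower≤n 4 r≡4+y r≤n) ,
    m≤n⇒m≤1+n (∸-monoʳ-≤ n (m≤n+m (3 + d) 4))
    where
      r≡4+y : 5 + 4 * q + (4 + d) ≡ 4 + (5 + 4 * q + d)
      r≡4+y = solve (q ∷ d ∷ [])
  escape-above4q+5-↓ _ _ q _ r≤n edge31 _ =
    7 + 4 * q , ↓1 r≡1+y , above4q+6-at1 q refl refl (lower≤n 1 r≡1+y r≤n) , m≤n⇒m≤1+n (∸-monoʳ-≤ n (n≤1+n 5))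
    where
      r≡1+y : 5 + 4 * q + 3 ≡ 1 + (7 + 4 * q)
      r≡1+y = solve (q ∷ [])
  escape-above4q+5-↓ _ _ _ _ _ (diff1 zero) ()

  escape-above4q+5-↑ : ∀ c c' q → 1 ≤ c → 5 + 4 * q + c ≤ n → Edge c' c → c' ≤ n →
                      ¬ Trapped (5 + 4 * q + c) c' → Escape c' (5 + 4 * q + c) (n ∸ (3 + c))
  escape-above4q+5-↑ c _ q 1≤c r≤n (diff1 _) _ _ with suc (5 + 4 * q + c) ≤? n
  ... | yes r+1≤n = suc (5 + 4 * q + c) , ↑1 refl , above4q+5 q (solve (q ∷ c ∷ [])) (m≤n⇒m≤1+n 1≤c) r+1≤n ,
                    m∸n≤1+m∸[1+n] n (3 + c)
  escape-above4q+5-↑ c _ zero _ r≤n (diff1 _) _ not-trapped | no r+1≰n =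
    contradiction (r≡n , trans (+-comm (suc c) 4) r≡n) not-trapped
    where
      r≡n : 5 + c ≡ n
      r≡n = ≤-antisym r≤n (≤-pred (≰⇒> r+1≰n))
  escape-above4q+5-↑ c _ (suc q) 1≤c r≤n (diff1 _) _ _ | no _ =
    5 + 4 * q + suc c , ↓3 r≡3+y , above4q+5 q refl (m≤n⇒m≤1+n 1≤c) (lower≤n 3 r≡3+y r≤n) ,
    m∸n≤1+m∸[1+n] n (3 + c)
    where
      r≡3+y : 5 + 4 * suc q + c ≡ 3 + (5 + 4 * q + suc c)
      r≡3+y = solve (q ∷ c ∷ [])
  escape-above4q+5-↑ c _ q 1≤c r≤n (diff3 _) _ _ =
    5 + 4 * q + c , stay , above4q+2 q (solve (q ∷ c ∷ [])) (s≤s (s≤s z≤n)) r≤n ,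
    n∸[3+c]≤1+potential c (3 + c) 1≤c
  escape-above4q+5-↑ c _ zero 1≤c _ (diff4 _) c'≤n _ =
    2 + c , ↓3 refl , below2 refl (m≤m+n 2 c) c'≤n , n∸[3+c]≤1+potential c (4 + c) 1≤c
  escape-above4q+5-↑ c _ (suc q) 1≤c r≤n (diff4 _) _ _ =
    2 + 4 * q + (4 + c) , ↓3 r≡3+y , above4q+2 q refl (s≤s (s≤s z≤n)) (lower≤n 3 r≡3+y r≤n) ,
    n∸[3+c]≤1+potential c (4 + c) 1≤c
    where
      r≡3+y : 5 + 4 * suc q + c ≡ 3 + (2 + 4 * q + (4 + c))
      r≡3+y = solve (q ∷ c ∷ [])
  escape-above4q+5-↑ _ _ q _ r≤n edge31 _ _ =
    5 + 4 * q , ↓1 r≡1+y , above4q+2 q (solve (q ∷ [])) (s≤s (s≤s z≤n)) (lower≤n 1 r≡1+y r≤n) ,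
    m≤n⇒m≤1+n (m≤n+m _ 1)
    where
      r≡1+y : 5 + 4 * q + 1 ≡ 1 + (5 + 4 * q)
      r≡1+y = solve (q ∷ [])

  escape-above4q+5 : ∀ c c' q → 1 ≤ c → 5 + 4 * q + c ≤ n → Adj c c' → 1 ≤ c' → c' ≤ n →
                     ¬ Trapped (5 + 4 * q + c) c' → Escape c' (5 + 4 * q + c) (n ∸ (3 + c))
  escape-above4q+5 c _ q 1≤c r≤n (inj₁ refl) _ _ _ = 5 + 4 * q + c , stay , above4q+5 q refl 1≤c r≤n , n≤1+n _
  escape-above4q+5 c c' q 1≤c r≤n (inj₂ (inj₁ e)) 1≤c' c'≤n free = escape-above4q+5-↓ c c' q 1≤c r≤n e 1≤c'
  escape-above4q+5 c c' q 1≤c r≤n (inj₂ (inj₂ e)) 1≤c' c'≤n free = escape-above4q+5-↑ c c' q 1≤c r≤n e c'≤n free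

  escape-below2 : ∀ r c' → 2 ≤ r → 2 + r ≤ n → Adj (2 + r) c' → 1 ≤ c' → c' ≤ n →
                  Escape c' r (descent (2 + r) + (n ∸ 4))
  escape-below2 r _ 2≤r c≤n (inj₁ refl) _ _ = r , stay , below2 refl 2≤r c≤n , n≤1+n _
  escape-below2 r _ 2≤r _ (inj₂ (inj₂ (diff1 _))) _ c'≤n =
    suc r , ↑1 refl , below2 refl (m≤n⇒m≤1+n 2≤r) c'≤n , descent+-mono (n ∸ 4) (n≤1+n (2 + r))
  escape-below2 r _ 2≤r _ (inj₂ (inj₂ (diff3 _))) _ c'≤n =
    3 + r , ↑3 refl , below2 refl (≤-trans 2≤r (m≤n+m r 3)) c'≤n , descent+-mono (n ∸ 4) (m≤n+m (2 + r) 3)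
  escape-below2 r _ 2≤r _ (inj₂ (inj₂ (diff4 _))) _ c'≤n =
    4 + r , ↑4 refl , below2 refl (≤-trans 2≤r (m≤n+m r 4)) c'≤n , descent+-mono (n ∸ 4) (m≤n+m (2 + r) 4)
  escape-below2 (suc (suc (suc d))) _ _ _ (inj₂ (inj₁ (diff1 _))) _ c'≤n =
    2 + d , ↓1 refl , below2 refl (s≤s (s≤s z≤n)) c'≤n , descent+-step (5 + d) (4 + d) (n ∸ 4) (lit≤ 5 8)
  escape-below2 _ _ _ _ (inj₂ (inj₁ (diff3 (suc (suc (suc (suc d))))))) _ c'≤n =
    2 + d , ↓3 refl , below2 refl (s≤s (s≤s z≤n)) c'≤n , descent+-step (7 + d) (4 + d) (n ∸ 4) (lit≤ 7 8)
  escape-below2 _ _ _ _ (inj₂ (inj₁ (diff4 (suc (suc (suc (suc d))))))) _ c'≤n =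
    2 + d , ↓4 refl , below2 refl (s≤s (s≤s z≤n)) c'≤n , descent+-step (8 + d) (4 + d) (n ∸ 4) ≤-refl
  escape-below2 2 _ _ _ (inj₂ (inj₁ (diff1 _))) _ _ = 5 , ↑3 refl , above4q+2 0 refl (lit≤ 2 3) (small≤n 5) , lit≤ 1 2
  escape-below2 2 _ _ _ (inj₂ (inj₁ (diff3 _))) _ _ = 6 , ↑4 refl , above4q+5 0 refl ≤-refl (small≤n 6) , ≤-refl
  escape-below2 3 _ _ _ (inj₂ (inj₁ (diff3 _))) _ _ = 4 , ↑1 refl , above4q+2 0 refl ≤-refl (small≤n 4) , ≤-refl
  escape-below2 4 _ _ _ (inj₂ (inj₁ (diff3 _))) _ _ = 5 , ↑1 refl , above4q+2 0 refl (lit≤ 2 3) (small≤n 5) , lit≤ 1 2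
  escape-below2 3 _ _ _ (inj₂ (inj₁ (diff4 _))) _ _ = 6 , ↑3 refl , above4q+5 0 refl ≤-refl (small≤n 6) , ≤-refl
  escape-below2 4 _ _ _ (inj₂ (inj₁ (diff4 _))) _ _ = 4 , stay , above4q+2 0 refl ≤-refl (small≤n 4) , ≤-refl
  escape-below2 5 _ _ _ (inj₂ (inj₁ (diff4 _))) _ _ = 5 , stay , above4q+2 0 refl (lit≤ 2 3) (small≤n 5) , ≤-refl
  escape-below2 _ _ _ _ (inj₂ (inj₁ (diff4 0))) () _
  escape-below2 0 _ () _ _ _ _
  escape-below2 1 _ (s≤s ()) _ _ _ _

  escape-below5+-↓1 : ∀ k r → 1 ≤ r → 4 + k + r ≤ n → Escape (4 + k + r) r (descent (5 + k + r) + (n ∸ 4))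
  escape-below5+-↓1 k (suc (suc d)) _ c'≤n =
    suc d , ↓1 refl , below5+ k (solve (k ∷ d ∷ [])) (s≤s z≤n) c'≤n ,
    descent+-step (5 + k + (2 + d)) (4 + k + (2 + d)) (n ∸ 4) (lit≤ 5 8)
  escape-below5+-↓1 (suc j) 1 _ c'≤n =
    1 , stay , below5+ j (solve (j ∷ [])) (s≤s z≤n) c'≤n , descent+-step (6 + j + 1) (5 + j + 1) (n ∸ 4) (lit≤ 5 8)
  escape-below5+-↓1 0 1 _ _ = 3 , adj13 , below2 refl (lit≤ 2 3) (small≤n 5) , lit≤ 1 2
  escape-below5+-↓1 _ 0 () _

  escape-below5+-↓3 : ∀ k r → 1 ≤ r → 2 + k + r ≤ n → Escape (2 + k + r) r (descent (5 + k + r) + (n ∸ 4))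
  escape-below5+-↓3 k (suc (suc (suc (suc d)))) _ c'≤n =
    suc d , ↓3 refl , below5+ k (solve (k ∷ d ∷ [])) (s≤s z≤n) c'≤n ,
    descent+-step (5 + k + (4 + d)) (2 + k + (4 + d)) (n ∸ 4) (lit≤ 5 6)
  escape-below5+-↓3 (suc (suc (suc j))) r 1≤r c'≤n =
    r , stay , below5+ j (solve (j ∷ r ∷ [])) 1≤r c'≤n , descent+-step (8 + j + r) (5 + j + r) (n ∸ 4) (lit≤ 5 6)
  escape-below5+-↓3 0 1 _ _ = 5 , ↑4 refl , above4q+2 0 refl (lit≤ 2 3) (small≤n 5) , lit≤ 1 2
  escape-below5+-↓3 1 1 _ _ = 2 , ↑1 refl , below2 refl ≤-refl (small≤n 4) , ≤-refl
  escape-below5+-↓3 2 1 _ _ = 3 , adj13 , below2 refl (lit≤ 2 3) (small≤n 5) , ≤-refl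
  escape-below5+-↓3 0 2 _ _ = 2 , stay , below2 refl ≤-refl (small≤n 4) , ≤-refl
  escape-below5+-↓3 1 2 _ _ = 3 , ↑1 refl , below2 refl (lit≤ 2 3) (small≤n 5) , ≤-refl
  escape-below5+-↓3 2 2 _ _ = 1 , ↓1 refl , below5+ 0 refl ≤-refl (small≤n 6) , ≤-refl
  escape-below5+-↓3 0 3 _ _ = 3 , stay , below2 refl (lit≤ 2 3) (small≤n 5) , ≤-refl
  escape-below5+-↓3 1 3 _ _ = 4 , ↑1 refl , below2 refl (lit≤ 2 4) (small≤n 6) , ≤-refl
  escape-below5+-↓3 2 3 _ _ = 2 , ↓1 refl , below5+ 0 refl (lit≤ 1 2) (small≤n 7) , lit≤ 2 3
  escape-below5+-↓3 _ 0 () _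

  escape-below5+-↓4 : ∀ k r → 1 ≤ r → 1 + k + r ≤ n → Escape (1 + k + r) r (descent (5 + k + r) + (n ∸ 4))
  escape-below5+-↓4 k (suc (suc (suc (suc (suc d))))) _ c'≤n =
    suc d , ↓4 refl , below5+ k (solve (k ∷ d ∷ [])) (s≤s z≤n) c'≤n ,
    descent+-step (5 + k + (5 + d)) (1 + k + (5 + d)) (n ∸ 4) ≤-refl
  escape-below5+-↓4 (suc (suc (suc (suc j)))) r 1≤r c'≤n =
    r , stay , below5+ j (solve (j ∷ r ∷ [])) 1≤r c'≤n , descent+-step (9 + j + r) (5 + j + r) (n ∸ 4) ≤-refl
  escape-below5+-↓4 0 1 _ _ = 4 , ↑3 refl , above4q+2 0 refl ≤-refl (small≤n 4) , ≤-refl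
  escape-below5+-↓4 1 1 _ _ = 5 , ↑4 refl , above4q+2 0 refl (lit≤ 2 3) (small≤n 5) , ≤-refl
  escape-below5+-↓4 2 1 _ _ = 2 , ↑1 refl , below2 refl ≤-refl (small≤n 4) , ≤-refl
  escape-below5+-↓4 3 1 _ _ = 3 , adj13 , below2 refl (lit≤ 2 3) (small≤n 5) , ≤-refl
  escape-below5+-↓4 0 2 _ _ = 5 , ↑3 refl , above4q+2 0 refl (lit≤ 2 3) (small≤n 5) , ≤-refl
  escape-below5+-↓4 1 2 _ _ = 2 , stay , below2 refl ≤-refl (small≤n 4) , ≤-refl
  escape-below5+-↓4 2 2 _ _ = 3 , ↑1 refl , below2 refl (lit≤ 2 3) (small≤n 5) , ≤-refl
  escape-below5+-↓4 3 2 _ _ = 1 , ↓1 refl , below5+ 0 refl ≤-refl (small≤n 6) , ≤-refl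
  escape-below5+-↓4 0 3 _ _ = 2 , ↓1 refl , below2 refl ≤-refl (small≤n 4) , ≤-refl
  escape-below5+-↓4 1 3 _ _ = 3 , stay , below2 refl (lit≤ 2 3) (small≤n 5) , ≤-refl
  escape-below5+-↓4 2 3 _ _ = 4 , ↑1 refl , below2 refl (lit≤ 2 4) (small≤n 6) , ≤-refl
  escape-below5+-↓4 3 3 _ _ = 2 , ↓1 refl , below5+ 0 refl (lit≤ 1 2) (small≤n 7) , ≤-refl
  escape-below5+-↓4 0 4 _ _ = 3 , ↓1 refl , below2 refl (lit≤ 2 3) (small≤n 5) , ≤-refl
  escape-below5+-↓4 1 4 _ _ = 4 , stay , below2 refl (lit≤ 2 4) (small≤n 6) , ≤-refl
  escape-below5+-↓4 2 4 _ _ = 5 , ↑1 refl , below2 refl (lit≤ 2 5) (small≤n 7) , ≤-refl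
  escape-below5+-↓4 3 4 _ _ = 3 , ↓1 refl , below5+ 0 refl (lit≤ 1 3) (small≤n 8) , ≤-refl
  escape-below5+-↓4 _ 0 () _

  escape-below5+-↓ : ∀ k r c' → 1 ≤ r → Edge (5 + k + r) c' → c' ≤ n →
                     Escape c' r (descent (5 + k + r) + (n ∸ 4))
  escape-below5+-↓ k r _ 1≤r (diff1 _) c'≤n = escape-below5+-↓1 k r 1≤r c'≤n
  escape-below5+-↓ k r _ 1≤r (diff3 _) c'≤n = escape-below5+-↓3 k r 1≤r c'≤n
  escape-below5+-↓ k r _ 1≤r (diff4 _) c'≤n = escape-below5+-↓4 k r 1≤r c'≤n

  escape-below5+-↑ : ∀ k r c' → 1 ≤ r → Edge c' (5 + k + r) → c' ≤ n →
                    Escape c' r (descent (5 + k + r) + (n ∸ 4))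
  escape-below5+-↑ k r _ 1≤r (diff1 _) c'≤n =
    suc r , ↑1 refl , below5+ k (solve (k ∷ r ∷ [])) (m≤n⇒m≤1+n 1≤r) c'≤n ,
    descent+-mono (n ∸ 4) (n≤1+n (5 + k + r))
  escape-below5+-↑ k r _ 1≤r (diff3 _) c'≤n =
    3 + r , ↑3 refl , below5+ k (solve (k ∷ r ∷ [])) (≤-trans 1≤r (m≤n+m r 3)) c'≤n ,
    descent+-mono (n ∸ 4) (m≤n+m (5 + k + r) 3)
  escape-below5+-↑ k r _ 1≤r (diff4 _) c'≤n =
    4 + r , ↑4 refl , below5+ k (solve (k ∷ r ∷ [])) (≤-trans 1≤r (m≤n+m r 4)) c'≤n ,
    descent+-mono (n ∸ 4) (m≤n+m (5 + k + r) 4)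

  escape-below5+ : ∀ k r c' → 1 ≤ r → 5 + k + r ≤ n → Adj (5 + k + r) c' → c' ≤ n →
                   Escape c' r (descent (5 + k + r) + (n ∸ 4))
  escape-below5+ k r _ 1≤r c≤n (inj₁ refl) _ = r , stay , below5+ k refl 1≤r c≤n , n≤1+n _
  escape-below5+ _ 0 _ () _ _ _
  escape-below5+ k r c' 1≤r _ (inj₂ (inj₁ e)) c'≤n = escape-below5+-↓ k r c' 1≤r e c'≤n
  escape-below5+ k r c' 1≤r _ (inj₂ (inj₂ e)) c'≤n = escape-below5+-↑ k r c' 1≤r e c'≤n

  escape : ∀ {c r} c' (s : Shape n c r) → Adj c c' → 1 ≤ c' → c' ≤ n → ¬ Trapped r c' →
           Escape c' r (potential s)
  escape {r = r} c' (below2 refl 2≤r c≤n) c~c' 1≤c' c'≤n _ = escape-below2 r c' 2≤r c≤n c~c' 1≤c' c'≤n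
  escape {r = r} c' (below5+ k refl 1≤r c≤n) c~c' 1≤c' c'≤n _ = escape-below5+ k r c' 1≤r c≤n c~c' c'≤n
  escape {c} c' (above4q+2 q refl 2≤c r≤n) c~c' 1≤c' c'≤n _ = escape-above4q+2 c c' q 2≤c r≤n c~c' 1≤c' c'≤n
  escape c' (above4q+6-at1 q refl refl r≤n) c~c' 1≤c' c'≤n _ = escape-at1 c' q r≤n c~c' 1≤c' c'≤n
  escape {c} c' (above4q+5 q refl 1≤c r≤n) c~c' 1≤c' c'≤n not-trapped =
    escape-above4q+5 c c' q 1≤c r≤n c~c' 1≤c' c'≤n not-trapped

  Flight : ℕ → ℕ → Set
  Flight r c' = Σ ℕ λ y → Adj r y × 1 ≤ y × y ≤ n × ¬ Adj c' y

  flee-top : ∀ d → 3 + d ≡ n → Flight (3 + d) (2 + d)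
  flee-top 0 r≡n = contradiction r≡n (small≢n 3)
  flee-top 1 r≡n = contradiction r≡n (small≢n 4)
  flee-top (suc (suc e)) r≡n =
    2 + e , ↓3 refl , s≤s z≤n , ≤-trans (m≤n+m _ 3) (≤-reflexive r≡n) ,
    Shape⇒¬Adj (below2 refl (s≤s (s≤s z≤n)) (≤-trans (n≤1+n _) (≤-reflexive r≡n)))

  flee : ∀ r c' → 1 ≤ r → r ≤ n → 1 ≤ c' → c' ≤ n → r ≢ c' → ¬ Trapped r c' → Flight r c'
  flee r c' 1≤r r≤n _ _ r≢c' _ with adj? c' r
  ... | no c'≁r = r , stay , 1≤r , r≤n , c'≁r
  ... | yes (inj₁ c'≡r) = contradiction (sym c'≡r) r≢c'
  flee 0 _ () _ _ _ _ _ | yes _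
  flee _ 0 _ _ () _ _ _ | yes _
  flee 1 _ _ _ _ _ _ _ | yes (inj₂ (inj₁ (diff1 _))) =
    4 , ↑3 refl , s≤s z≤n , small≤n 4 , Shape⇒¬Adj (above4q+2 0 refl ≤-refl (small≤n 4))
  flee 2 _ _ _ _ _ _ _ | yes (inj₂ (inj₁ (diff1 _))) =
    5 , ↑3 refl , s≤s z≤n , small≤n 5 , Shape⇒¬Adj (above4q+2 0 refl (lit≤ 2 3) (small≤n 5))
  flee (suc (suc (suc d))) _ _ r≤n _ c'≤n _ _ | yes (inj₂ (inj₁ (diff1 _))) =
    2 + d , ↓1 refl , s≤s z≤n , ≤-trans (n≤1+n _) r≤n , Shape⇒¬Adj (below2 refl (s≤s (s≤s z≤n)) c'≤n)
  flee (suc r) _ _ _ _ c'≤n _ _ | yes (inj₂ (inj₁ (diff3 _))) =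
    2 + r , ↑1 refl , s≤s z≤n , ≤-trans (m≤n+m _ 2) c'≤n , Shape⇒¬Adj (below2 refl (s≤s (s≤s z≤n)) c'≤n)
  flee 1 _ _ _ _ c'≤n _ _ | yes (inj₂ (inj₁ (diff4 _))) =
    3 , adj13 , s≤s z≤n , small≤n 3 , Shape⇒¬Adj (below2 refl (lit≤ 2 3) c'≤n)
  flee (suc (suc d)) _ _ r≤n _ c'≤n _ _ | yes (inj₂ (inj₁ (diff4 _))) =
    suc d , ↓1 refl , s≤s z≤n , ≤-trans (n≤1+n _) r≤n , Shape⇒¬Adj (below5+ 0 refl (s≤s z≤n) c'≤n)
  flee _ _ _ _ _ _ _ _ | yes (inj₂ (inj₁ edge31)) =
    5 , ↑4 refl , s≤s z≤n , small≤n 5 , Shape⇒¬Adj (above4q+2 0 refl (lit≤ 2 3) (small≤n 5))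
  flee _ 1 _ _ _ _ _ _ | yes (inj₂ (inj₂ (diff1 _))) =
    6 , ↑4 refl , s≤s z≤n , small≤n 6 , Shape⇒¬Adj (above4q+5 0 refl ≤-refl (small≤n 6))
  flee _ (suc (suc d)) _ r≤n _ _ _ _ | yes (inj₂ (inj₂ (diff1 _))) with 4 + d ≤? n
  ... | yes y≤n = 4 + d , ↑1 refl , s≤s z≤n , y≤n , Shape⇒¬Adj (above4q+2 0 refl (s≤s (s≤s z≤n)) y≤n)
  ... | no y≰n = flee-top d (≤-antisym r≤n (≤-pred (≰⇒> y≰n)))
  flee _ 1 _ _ _ _ _ _ | yes (inj₂ (inj₂ (diff3 _))) =
    7 , ↑3 refl , s≤s z≤n , small≤n 7 , Shape⇒¬Adj (above4q+6-at1 0 refl refl (small≤n 7))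
  flee _ (suc (suc d)) _ r≤n _ _ _ _ | yes (inj₂ (inj₂ (diff3 _))) =
    4 + d , ↓1 refl , s≤s z≤n , y≤n , Shape⇒¬Adj (above4q+2 0 refl (s≤s (s≤s z≤n)) y≤n)
    where
      y≤n : 4 + d ≤ n
      y≤n = ≤-trans (n≤1+n _) r≤n
  flee r c' _ r≤n 1≤c' _ _ not-trapped | yes (inj₂ (inj₂ (diff4 _))) with suc r ≤? n
  ... | yes y≤n = suc r , ↑1 refl , s≤s z≤n , y≤n , Shape⇒¬Adj (above4q+5 0 refl 1≤c' y≤n)
  ... | no y≰n = contradiction (r≡n , trans (+-comm c' 4) r≡n) not-trapped
    where
      r≡n : 4 + c' ≡ n
      r≡n = ≤-antisym r≤n (≤-pred (≰⇒> y≰n))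
  flee _ _ _ _ _ _ _ _ | yes (inj₂ (inj₂ edge31)) =
    6 , ↑3 refl , s≤s z≤n , small≤n 6 , Shape⇒¬Adj (above4q+5 0 refl ≤-refl (small≤n 6))

  trapped-potential≤2 : ∀ {c c' r} (s : Shape n c r) → Trapped r c' → Adj c c' → potential s ≤ 2
  trapped-potential≤2 {r = r} (below2 refl _ c≤n) (r≡n , _) _ =
    contradiction (subst (2 + r ≤_) (sym r≡n) c≤n) (<⇒≱ (s≤s (m≤n+m r 1)))
  trapped-potential≤2 {r = r} (below5+ k refl _ c≤n) (r≡n , _) _ =
    contradiction (subst (5 + k + r ≤_) (sym r≡n) c≤n) (<⇒≱ (s≤s (m≤n+m r (4 + k))))
  trapped-potential≤2 (above4q+6-at1 _ refl _ _) (_ , c'+4≡n) c~c' =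
    contradiction (subst (10 ≤_) (sym c'+4≡n) 10≤n) (<⇒≱ (s≤s (+-monoˡ-≤ 4 (1-adj⇒≤5 c~c'))))
  trapped-potential≤2 {c} {c'} (above4q+2 zero refl _ _) (r≡n , c'+4≡n) c~c' =
    contradiction (trans (cong (_+ 4) (sym c'≡1)) c'+4≡n) (small≢n 5)
    where
      c≡2+c' : c ≡ 2 + c'
      c≡2+c' = +-cancelˡ-≡ 2 c (2 + c') (trans r≡n (trans (sym c'+4≡n) (+-comm c' 4)))
      c'≡1 : c' ≡ 1
      c'≡1 = proj₂ (Adj-gap 2 c' (Adj-sym (subst (λ x → Adj x c') c≡2+c' c~c'))) refl
  trapped-potential≤2 {c} {c'} (above4q+2 (suc q) refl 2≤c _) (r≡n , c'+4≡n) c~c' =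
    contradiction c~c' (Shape⇒¬Adj (above4q+2 q c'≡ 2≤c (subst (c' ≤_) c'+4≡n (m≤m+n c' 4))))
    where
      c'≡ : c' ≡ 2 + 4 * q + c
      c'≡ = +-cancelʳ-≡ 4 c' (2 + 4 * q + c) (trans c'+4≡n (trans (sym r≡n) (solve (q ∷ c ∷ []))))
  trapped-potential≤2 {c} (above4q+5 zero refl _ _) (r≡n , _) _ =
    subst (λ m → m ∸ (3 + c) ≤ 2) r≡n (≤-reflexive (m+n∸n≡m 2 (3 + c)))
  trapped-potential≤2 {c} {c'} (above4q+5 (suc q) refl 1≤c _) (r≡n , c'+4≡n) c~c' =
    contradiction c~c' (Shape⇒¬Adj (above4q+5 q c'≡ 1≤c (subst (c' ≤_) c'+4≡n (m≤m+n c' 4))))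
    where
      c'≡ : c' ≡ 5 + 4 * q + c
      c'≡ = +-cancelʳ-≡ 4 c' (5 + 4 * q + c) (trans c'+4≡n (trans (sym r≡n) (solve (q ∷ c ∷ []))))

  B : ℕ
  B = ℓ + (n ∸ 4)

  high-descent : ∀ a → n ≤ a + 3 → B ≤ descent a + (n ∸ 4)
  high-descent a n≤a+3 = +-monoˡ-≤ (n ∸ 4) (descent-bound ℓ a n≤a+3)

  Reset : ℕ → ℕ → Set
  Reset a b = Σ ℕ λ z → Adj b z × Σ (Shape n a z) λ s → B ≤ potential s

  reset-below : ∀ g b → 1 ≤ g → 1 ≤ b → 7 ≤ g + b → g + b ≤ n → B ≤ descent (g + b) + (n ∸ 4) → Reset (g + b) b
  reset-below 1 (suc z) _ _ 7≤a a≤n high =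
    z , ↓1 refl , below2 refl (≤-trans (lit≤ 2 5) (≤-pred (≤-pred 7≤a))) a≤n , high
  reset-below 2 b _ _ 7≤a a≤n high = b , stay , below2 refl (≤-trans (lit≤ 2 5) (≤-pred (≤-pred 7≤a))) a≤n , high
  reset-below 3 b _ 1≤b _ a≤n high = suc b , ↑1 refl , below2 refl (s≤s 1≤b) a≤n , high
  reset-below 4 (suc z) _ _ 7≤a a≤n high =
    z , ↓1 refl , below5+ 0 refl (≤-trans (lit≤ 1 2) (≤-pred (≤-pred (≤-pred (≤-pred (≤-pred 7≤a)))))) a≤n , high
  reset-below (suc (suc (suc (suc (suc k))))) b _ 1≤b _ a≤n high = b , stay , below5+ k refl 1≤b a≤n , high
  reset-below 0 _ () _ _ _ _
  reset-below 1 0 _ () _ _ _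
  reset-below 4 0 _ () _ _ _

  reset-above : ∀ g a → 1 ≤ g → g ≤ 3 → 4 ≤ a → g + a ≤ n → B ≤ descent a + (n ∸ 4) → Reset a (g + a)
  reset-above 1 (suc (suc z)) _ _ 4≤a b≤n high =
    z , ↓3 refl , below2 refl (≤-pred (≤-pred 4≤a)) (≤-trans (n≤1+n _) b≤n) , high
  reset-above 2 a _ _ 4≤a b≤n high = 2 + a , stay , above4q+2 0 refl (≤-trans (lit≤ 2 4) 4≤a) b≤n , high
  reset-above 3 a _ _ 4≤a b≤n high =
    2 + a , ↓1 refl , above4q+2 0 refl (≤-trans (lit≤ 2 4) 4≤a) (≤-trans (n≤1+n _) b≤n) , high
  reset-above 0 _ () _ _ _ _
  reset-above 1 1 _ _ (s≤s ()) _ _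
  reset-above (suc (suc (suc (suc _)))) _ _ (s≤s (s≤s (s≤s ()))) _ _ _

  reset : ∀ a b → n ≤ a + 3 → a ≤ n → 1 ≤ b → b ≤ n → b ≢ a → Reset a b
  reset a b n≤a+3 a≤n 1≤b b≤n b≢a with <-cmp b a
  ... | tri≈ _ b≡a _ = contradiction b≡a b≢a
  ... | tri< b<a _ _ with a ∸ b | m∸n+n≡m (<⇒≤ b<a) | m<n⇒0<n∸m b<a
  ...   | g | refl | 1≤g = reset-below g b 1≤g 1≤b 7≤a a≤n (high-descent (g + b) n≤a+3)
    where
      7≤a : 7 ≤ g + b
      7≤a = +-cancelʳ-≤ 3 7 (g + b) (≤-trans 10≤n n≤a+3)
  reset a b n≤a+3 a≤n 1≤b b≤n b≢a | tri> _ _ a<b with b ∸ a | m∸n+n≡m (<⇒≤ a<b) | m<n⇒0<n∸m a<b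
  ...   | g | refl | 1≤g =
    reset-above g a 1≤g (+-cancelʳ-≤ a g 3 (≤-trans b≤n (subst (n ≤_) (+-comm a 3) n≤a+3)))
                (≤-trans (lit≤ 4 7) 7≤a) b≤n (high-descent a n≤a+3)
    where
      7≤a : 7 ≤ a
      7≤a = +-cancelʳ-≤ 3 7 a (≤-trans 10≤n n≤a+3)

  robber-start : ∀ c → 1 ≤ c → c ≤ n → Σ ℕ λ r → Σ (Shape n c r) λ s → n ∸ 4 ≤ potential s
  robber-start 1 _ _ = 6 , above4q+5 0 refl ≤-refl (small≤n 6) , ≤-refl
  robber-start (suc (suc c)) _ c≤n with 4 + c ≤? n
  ... | yes r≤n = 4 + c , above4q+2 0 refl (s≤s (s≤s z≤n)) r≤n , m≤n+m _ _
  ... | no r≰n = c , below2 refl 2≤c c≤n , m≤n+m _ _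
    where
      2≤c : 2 ≤ c
      2≤c = +-cancelˡ-≤ 3 2 c (≤-trans (lit≤ 5 10) (≤-trans 10≤n (≤-pred (≰⇒> r≰n))))
  robber-start 0 () _

module LowerBound (ℓ : ℕ) (2≤ℓ : 2 ≤ ℓ) where
  open Escapes ℓ 2≤ℓ
  open import Data.Vec using ([]; _∷_)
  open Game (HAdj n) _≟_
  open GameFacts (HAdj n) _≟_ (inj₁ refl)

  -- With k further robbers alive the cop needs potential s rounds for this one and B for each of
  -- the others.  An exposed robber may be caught next round, but only at a vertex ≥ n − 3.
  data Status (t k c r : ℕ) : Set where
    hidden  : (s : Shape n c r) → t < potential s + k * B → Status t k c r
    exposed : t < 1 + k * B → (Adj c r → n ≤ r + 3) → Status t k c r

  exposed-if-adjacent : ∀ {t k c r} → Status t k c r → Adj c r → t < 1 + k * B × n ≤ r + 3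
  exposed-if-adjacent (hidden s _)        c~r = contradiction c~r (Shape⇒¬Adj s)
  exposed-if-adjacent (exposed t<1+kB high) c~r = t<1+kB , high c~r

  -- Cornered robbers spread over the neighbours n, n − 1, n − 3 of n − 4, one robber each.
  offset : Fin 3 → ℕ
  offset Fin.zero                     = 4
  offset (Fin.suc Fin.zero)           = 3
  offset (Fin.suc (Fin.suc Fin.zero)) = 1

  offset-injective : ∀ i j → offset i ≡ offset j → i ≡ j
  offset-injective Fin.zero                     Fin.zero                     _ = refl
  offset-injective (Fin.suc Fin.zero)           (Fin.suc Fin.zero)           _ = refl
  offset-injective (Fin.suc (Fin.suc Fin.zero)) (Fin.suc (Fin.suc Fin.zero)) _ = refl
  offset-injective Fin.zero                     (Fin.suc Fin.zero)           ()
  offset-injective Fin.zero                     (Fin.suc (Fin.suc Fin.zero)) ()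
  offset-injective (Fin.suc Fin.zero)           Fin.zero                     ()
  offset-injective (Fin.suc Fin.zero)           (Fin.suc (Fin.suc Fin.zero)) ()
  offset-injective (Fin.suc (Fin.suc Fin.zero)) Fin.zero                     ()
  offset-injective (Fin.suc (Fin.suc Fin.zero)) (Fin.suc Fin.zero)           ()

  corner : Fin 3 → ℕ → ℕ
  corner i m = offset i + m

  corner-adj : ∀ i m → Adj (4 + m) (corner i m)
  corner-adj Fin.zero                     m = stay
  corner-adj (Fin.suc Fin.zero)           m = ↓1 refl
  corner-adj (Fin.suc (Fin.suc Fin.zero)) m = ↓3 refl

  offset-bounds : ∀ i → 1 ≤ offset i × offset i ≤ 4
  offset-bounds Fin.zero                     = s≤s z≤n , ≤-refl
  offset-bounds (Fin.suc Fin.zero)           = s≤s z≤n , lit≤ 3 4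
  offset-bounds (Fin.suc (Fin.suc Fin.zero)) = s≤s z≤n , lit≤ 1 4

  corner-injective : ∀ i j m → corner i m ≡ corner j m → i ≡ j
  corner-injective i j m eq = offset-injective i j (+-cancelʳ-≡ m (offset i) (offset j) eq)

  data Outcome (c' : ℕ) (i : Fin 3) (y : ℕ) : Set where
    unseen   : ¬ Adj c' y → Outcome c' i y
    cornered : y ≡ corner i c' → Outcome c' i y

  Outcome⇒≢ : ∀ {c' i y} → Outcome c' i y → y ≢ c'
  Outcome⇒≢ (unseen c'≁y) refl = c'≁y stay
  Outcome⇒≢ {c'} {i} (cornered refl) y≡c' =
    <-irrefl (sym y≡c') (+-monoˡ-≤ c' (proj₁ (offset-bounds i)))

  spend : ∀ {t v v' K} → suc t < v + K → v ≤ suc v' → t < v' + K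
  spend {K = K} budget v≤1+v' = ≤-pred (≤-trans budget (+-monoˡ-≤ K v≤1+v'))

  record Move (t k : ℕ) (c' : Fin n) (i : Fin 3) (r : Fin n) : Set where
    field
      dest    : Fin n
      step    : HAdj n r dest
      status  : Status t k (label c') (label dest)
      outcome : Outcome (label c') i (label dest)

  realize : ∀ {t k} (c' r : Fin n) i y → Adj (label r) y → 1 ≤ y → y ≤ n →
            Status t k (label c') y → Outcome (label c') i y → Move t k c' i r
  realize c' r i y r~y 1≤y y≤n st out with vertex y 1≤y y≤n
  ... | v , refl = record { dest = v ; step = Adj⇒HAdj r~y ; status = st ; outcome = out }

  corner-move : ∀ {t k} (c' r : Fin n) i → Trapped (label r) (label c') → t < 1 + k * B → Move t k c' i r
  corner-move c' r i (r≡n , c'+4≡n) budget =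
    realize c' r i (corner i m) (subst (λ x → Adj x (corner i m)) (sym r≡4+m) (corner-adj i m))
            (≤-trans (proj₁ (offset-bounds i)) (m≤m+n _ m))
            (subst (corner i m ≤_) 4+m≡n (+-monoˡ-≤ m (proj₂ (offset-bounds i))))
            (exposed budget (λ _ → subst (_≤ corner i m + 3) 4+m≡n corner-high))
            (cornered refl)
    where
      m = label c'
      4+m≡n : 4 + m ≡ n
      4+m≡n = trans (+-comm 4 m) c'+4≡n
      r≡4+m : label r ≡ 4 + m
      r≡4+m = trans r≡n (sym 4+m≡n)
      corner-high : 4 + m ≤ corner i m + 3
      corner-high =
        subst (_≤ corner i m + 3) (+-comm (1 + m) 3) (+-monoˡ-≤ 3 (+-monoˡ-≤ m (proj₁ (offset-bounds i))))

  quiet-move : ∀ {t k} (c c' r : Fin n) i → HAdj n c c' → r ≢ c' → Status (suc t) k (label c) (label r) →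
               Move t k c' i r
  quiet-move c c' r i c~c' r≢c' st with label r ℕ.≟ n ×-dec label c' + 4 ℕ.≟ n
  quiet-move c c' r i c~c' r≢c' (hidden s budget) | yes trapped =
    corner-move c' r i trapped (spend budget (trapped-potential≤2 s trapped (HAdj⇒Adj c~c')))
  quiet-move c c' r i c~c' r≢c' (exposed budget _) | yes trapped = corner-move c' r i trapped (<⇒≤ budget)
  quiet-move c c' r i c~c' r≢c' (hidden s budget) | no free
    with escape (label c') s (HAdj⇒Adj c~c') (label≥1 c') (label≤n c') free
  ... | y , r~y , s' , v≤1+v' =
    realize c' r i y r~y (proj₁ (Shape-robber-bounds s')) (proj₂ (Shape-robber-bounds s'))
            (hidden s' (spend budget v≤1+v')) (unseen (Shape⇒¬Adj s'))
  quiet-move c c' r i c~c' r≢c' (exposed budget _) | no free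
    with flee (label r) (label c') (label≥1 r) (label≤n r) (label≥1 c') (label≤n c')
              (r≢c' ∘ label-injective) free
  ... | y , r~y , 1≤y , y≤n , c'≁y =
    realize c' r i y r~y 1≤y y≤n (exposed (<⇒≤ budget) (λ c'~y → contradiction c'~y c'≁y)) (unseen c'≁y)

  reset-move : ∀ {t k} (c' b : Fin n) i → n ≤ label c' + 3 → b ≢ c' → t < suc k * B → Move t k c' i b
  reset-move {t} {k} c' b i n≤c'+3 b≢c' budget
    with reset (label c') (label b) n≤c'+3 (label≤n c') (label≥1 b) (label≤n b) (b≢c' ∘ label-injective)
  ... | z , b~z , s , B≤potential =
    realize c' b i z b~z (proj₁ (Shape-robber-bounds s)) (proj₂ (Shape-robber-bounds s))
            (hidden s (≤-trans budget (+-monoˡ-≤ (k * B) B≤potential))) (unseen (Shape⇒¬Adj s))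

  StatusOf : ℕ → ℕ → Fin n → Robber → Set
  StatusOf t k c nothing  = ⊤
  StatusOf t k c (just r) = Status t k (label c) (label r)

  OutcomeOf : Fin n → Fin 3 → Robber → Set
  OutcomeOf c' i nothing  = ⊤
  OutcomeOf c' i (just y) = Outcome (label c') i (label y)

  Apart : Fin n → Robber → Robber → Set
  Apart c nothing  _        = ⊤
  Apart c (just a) nothing  = ⊤
  Apart c (just a) (just b) = Adj (label c) (label a) → a ≢ b

  outcomes-apart : ∀ {c' i j} x y → i ≢ j → OutcomeOf c' i x → OutcomeOf c' j y → Apart c' x y
  outcomes-apart nothing  _        _   _ _ = tt
  outcomes-apart (just a) nothing  _   _ _ = tt
  outcomes-apart (just a) (just b) _   (unseen c'≁a) _ c'~a _ = c'≁a c'~a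
  outcomes-apart (just a) (just b) _   (cornered _) (unseen c'≁b) c'~a refl = c'≁b c'~a
  outcomes-apart {c'} {i} {j} (just a) (just b) i≢j (cornered a≡) (cornered b≡) _ refl =
    i≢j (corner-injective i j (label c') (trans (sym a≡) b≡))

  record Safe (t : ℕ) (c : Fin n) (rs : Vec Robber 3) : Set where
    field
      spare  : ℕ
      count  : #alive rs ≡ suc spare
      status : ∀ i → StatusOf t spare c (lookup rs i)
      apart  : ∀ i j → i ≢ j → Apart c (lookup rs i) (lookup rs j)

  record Response (t k : ℕ) (c' : Fin n) (i : Fin 3) (x : Robber) : Set where
    field
      next    : Robber
      step    : Step (catch c' x) next
      avoids  : next ≢ just c'
      status  : StatusOf t k c' next
      outcome : OutcomeOf c' i next

  stay-captured : ∀ {t k c' i} → Response t k c' i nothing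
  stay-captured = record { next = nothing ; step = dead ; avoids = λ () ; status = tt ; outcome = tt }

  get-captured : ∀ {t k c' i} → Response t k c' i (just c')
  get-captured {c' = c'} =
    record { next = nothing ; step = subst (λ x → Step x nothing) (sym (catch-hit c')) dead
           ; avoids = λ () ; status = tt ; outcome = tt }

  Move⇒Response : ∀ {t k c' i r} → r ≢ c' → Move t k c' i r → Response t k c' i (just r)
  Move⇒Response {c' = c'} {r = r} r≢c' mv = record
    { next    = just dest
    ; step    = subst (λ x → Step x (just dest)) (sym (catch-miss r≢c')) (alive step)
    ; avoids  = λ eq → Outcome⇒≢ outcome (cong label (just-injective eq))
    ; status  = status
    ; outcome = outcome }
    where open Move mv

  module _ {t k} {c' : Fin n} (rs : Vec Robber 3) (answer : ∀ i → Response t k c' i (lookup rs i)) where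
    private
      ys : Vec Robber 3
      ys = tabulate (λ i → Response.next (answer i))

      at : ∀ i → lookup ys i ≡ Response.next (answer i)
      at = lookup∘tabulate (λ i → Response.next (answer i))

    responses-step : Steps (catchAll c' rs) ys
    responses-step = Steps-pointwise λ i →
      subst₂ Step (sym (lookup-map i (catch c') rs)) (sym (at i)) (Response.step (answer i))

    responses-avoid : ∀ i → lookup ys i ≢ just c'
    responses-avoid i eq = Response.avoids (answer i) (trans (sym (at i)) eq)

    responses-status : ∀ i → StatusOf t k c' (lookup ys i)
    responses-status i = subst (StatusOf t k c') (sym (at i)) (Response.status (answer i))

    responses-apart : ∀ i j → i ≢ j → Apart c' (lookup ys i) (lookup ys j)
    responses-apart i j i≢j = subst₂ (Apart c') (sym (at i)) (sym (at j))
      (outcomes-apart _ _ i≢j (Response.outcome (answer i)) (Response.outcome (answer j)))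

    responses-alive : (∀ i → isAlive (Response.next (answer i)) ≡ isAlive (lookup rs i)) → #alive ys ≡ #alive rs
    responses-alive same = #alive-pointwise rs ys λ i → trans (cong isAlive (at i)) (same i)

    responses-capture : ∀ j → lookup rs j ≡ just c' → Response.next (answer j) ≡ nothing →
                        (∀ i → i ≢ j → isAlive (Response.next (answer i)) ≡ isAlive (lookup rs i)) →
                        #alive rs ≡ suc (#alive ys)
    responses-capture j rsj≡c' captured same = trans
      (#alive-capture rs ys j (trans (at j) captured) λ i i≢j → trans (cong isAlive (at i)) (same i i≢j))
      (cong (λ x → isAlive x + #alive ys) rsj≡c')

  Evasion : ℕ → Fin n → Vec Robber 3 → Set
  Evasion t c' rs =
    Σ (Vec Robber 3) λ ys → Steps (catchAll c' rs) ys × (∀ i → lookup ys i ≢ just c') × Safe t c' ys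

  quiet-response : ∀ {t k} (c c' : Fin n) i x → HAdj n c c' → x ≢ just c' → StatusOf (suc t) k c x →
                   Σ (Response t k c' i x) λ answer → isAlive (Response.next answer) ≡ isAlive x
  quiet-response c c' i nothing  _    _     _  = stay-captured , refl
  quiet-response c c' i (just r) c~c' r≢c'  st =
    Move⇒Response (r≢c' ∘ cong just) (quiet-move c c' r i c~c' (r≢c' ∘ cong just) st) , refl

  quiet-round : ∀ {t c rs} → Safe (suc t) c rs → ∀ c' → HAdj n c c' → (∀ j → lookup rs j ≢ just c') →
                Evasion t c' rs
  quiet-round {t} {c} {rs} safe c' c~c' free =
    _ , responses-step rs answer , responses-avoid rs answer ,
    record { spare  = spare
           ; count  = trans (responses-alive rs answer (proj₂ ∘ response)) count
           ; status = responses-status rs answer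
           ; apart  = responses-apart rs answer }
    where
      open Safe safe
      response : ∀ i → Σ (Response t spare c' i (lookup rs i)) λ answer →
                   isAlive (Response.next answer) ≡ isAlive (lookup rs i)
      response i = quiet-response c c' i (lookup rs i) c~c' (free i) (status i)
      answer : ∀ i → Response t spare c' i (lookup rs i)
      answer = proj₁ ∘ response

  survivor : ∀ {t k} (c c' : Fin n) i x → HAdj n c c' → n ≤ label c' + 3 → t < suc k * B → Apart c (just c') x →
             Σ (Response t k c' i x) λ answer → isAlive (Response.next answer) ≡ isAlive x
  survivor c c' i nothing  _    _    _      _     = stay-captured , refl
  survivor c c' i (just b) c~c' high budget apart =
    Move⇒Response b≢c' (reset-move c' b i high b≢c' budget) , refl
    where
      b≢c' : b ≢ c'
      b≢c' b≡c' = apart (HAdj⇒Adj c~c') (sym b≡c')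

  capture-round : ∀ {t c rs} → Safe (suc t) c rs → ∀ c' → HAdj n c c' → ∀ j → lookup rs j ≡ just c' →
                  Evasion t c' rs
  capture-round {t} {c} record { spare = zero ; status = status } c' c~c' j rsj≡c'
    with exposed-if-adjacent (subst (StatusOf (suc t) 0 c) rsj≡c' (status j)) (HAdj⇒Adj c~c')
  ... | s≤s () , _
  capture-round {t} {c} {rs} record { spare = suc k ; count = count ; status = status ; apart = apart } c' c~c' j rsj≡c'
    with exposed-if-adjacent (subst (StatusOf (suc t) (suc k) c) rsj≡c' (status j)) (HAdj⇒Adj c~c')
  ... | s≤s budget , high =
    _ , responses-step rs answer , responses-avoid rs answer ,
    record { spare  = k
           ; count  = sym (suc-injective (trans (sym count) (responses-capture rs answer j rsj≡c' captured same)))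
           ; status = responses-status rs answer
           ; apart  = responses-apart rs answer }
    where
      response : ∀ i → Σ (Response t k c' i (lookup rs i)) λ answer →
                   (i ≡ j → Response.next answer ≡ nothing) ×
                   (i ≢ j → isAlive (Response.next answer) ≡ isAlive (lookup rs i))
      response i with i Fin.≟ j
      response i | yes refl rewrite rsj≡c' = get-captured , (λ _ → refl) , (λ i≢i → contradiction refl i≢i)
      response i | no i≢j with survivor c c' i (lookup rs i) c~c' high budget
                                  (subst (λ x → Apart c x (lookup rs i)) rsj≡c' (apart j i (i≢j ∘ sym)))
      ... | answer , same = answer , (λ i≡j → contradiction i≡j i≢j) , (λ _ → same)
      answer : ∀ i → Response t k c' i (lookup rs i)
      answer = proj₁ ∘ response
      captured : Response.next (answer j) ≡ nothing
      captured = proj₁ (proj₂ (response j)) refl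
      same : ∀ i → i ≢ j → isAlive (Response.next (answer i)) ≡ isAlive (lookup rs i)
      same i = proj₂ (proj₂ (response i))

  evade : ∀ {t c rs} → Safe (suc t) c rs → ∀ c' → HAdj n c c' → Evasion t c' rs
  evade {rs = rs} safe c' c~c' with any? (λ j → Maybe.≡-dec _≟_ (lookup rs j) (just c'))
  ... | yes (j , rsj≡c') = capture-round safe c' c~c' j rsj≡c'
  ... | no nobody        = quiet-round safe c' c~c' (λ j rsj≡c' → nobody (j , rsj≡c'))

  Safe⇒¬AllCaptured : ∀ {c rs} → Safe 0 c rs → ¬ AllCaptured rs
  Safe⇒¬AllCaptured safe captured = 0≢1+n (trans (sym (AllCaptured⇒#alive≡0 captured)) (Safe.count safe))

  initial-budget : ∀ w m → 2 * w + 3 * m ≡ m + 2 * (w + m)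
  initial-budget = solve-∀

  no-capture-before : ∀ t → t < 2 * ℓ + 3 * (n ∸ 4) → ¬ CaptureBy 3 t
  no-capture-before t t<T (c₀ , win) with robber-start (label c₀) (label≥1 c₀) (label≤n c₀)
  ... | r , s , n∸4≤potential with vertex r (proj₁ (Shape-robber-bounds s)) (proj₂ (Shape-robber-bounds s))
  ...   | r₀ , refl = Safe⇒¬Win Safe Safe⇒¬AllCaptured evade t c₀ _ start (win (replicate 3 r₀))
    where
      r₀≢c₀ : r₀ ≢ c₀
      r₀≢c₀ refl = Shape⇒¬Adj s stay
      budget : t < potential s + 2 * B
      budget = ≤-trans t<T (subst (_≤ potential s + 2 * B) (sym (initial-budget ℓ (n ∸ 4)))
                                  (+-monoˡ-≤ (2 * B) n∸4≤potential))
      start : Safe t c₀ (catchAll c₀ (map just (replicate 3 r₀)))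
      start = subst (Safe t c₀) (sym (cong (replicate 3) (catch-miss r₀≢c₀))) record
        { spare  = 2
        ; count  = refl
        ; status = λ i → subst (StatusOf t 2 c₀) (sym (lookup-replicate i (just r₀))) (hidden s budget)
        ; apart  = λ i j _ → subst₂ (Apart c₀) (sym (lookup-replicate i (just r₀))) (sym (lookup-replicate j (just r₀)))
                               (λ c₀~r₀ → contradiction c₀~r₀ (Shape⇒¬Adj s)) }

theorem3p5 : ∀ (ℓ : ℕ) → 2 ≤ ℓ →
    Game.CaptTime (HAdj (4 * ℓ + 2)) _≟_ 3 (2 * ℓ + 3 * ((4 * ℓ + 2) ∸ 4))
theorem3p5 ℓ 2≤ℓ =
  capture-in-time (4 * ℓ + 2) ℓ (≤-trans (lit≤ 6 10) (Escapes.10≤n ℓ 2≤ℓ)) ≤-refl ,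
  LowerBound.no-capture-before ℓ 2≤ℓ
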